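{- Let $t, \ell, p, \chi, L, b$ be positive integers with $p \ge 2$, and assume that for every integer $0 \le t' < t$ there is an integer $K_{t'}$ such that every hypergraph $\mathcal{G}$ which contains no sunflower with $p$ petals and kernel of size at most $t'-1$, and which satisfies $\chi(\mathcal{G}_{S'}, \ell) \leq \chi$ for all sets $S'$ of $t'$ vertices of $\mathcal{G}$, has $\chi(\mathcal{G}, t'+\ell) \leq K_{t'}$. Then there is a positive integer $K_3$ such that the following holds. Suppose that $\mathcal{H}$ is a hypergraph and $e_1, \dots, e_L$ are edges of $\mathcal{H}$ such that: $\mathcal{H}$ does not contain a sunflower with $p$ petals and kernel of size at most $t-1$; for all sets $S$ of $t$ vertices, $\chi(\mathcal{H}_S, \ell) \leq \chi$; the sequence $(e_1, \dots, e_L)$ is $(t+\ell-1)$-split-degenerate; and $\chi(\mathcal{H}, t+\ell) \geq K_3$. Then $\mathcal{H}$ contains a $b$-bromeliad which is $(t+\ell-1)$-compatible with $(e_1, \dots, e_L)$.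
   Context: A hypergraph $\mathcal{H}$ consists of a finite vertex set $V(\mathcal{H})$ and a set of edges, each a subset of $V(\mathcal{H})$. A colouring is a function $V(\mathcal{H}) \to \mathbb{N}$; it uses $m$ colours if its image has size $m$. A colouring is $c$-strong if every edge $e$ contains vertices of at least $\min\{c, |e|\}$ distinct colours; $\chi(\mathcal{H}, c)$ is the smallest number of colours in a $c$-strong colouring. For $S \subseteq V(\mathcal{H})$, the link $\mathcal{H}_S$ has vertex set $V(\mathcal{H}) \setminus S$ and edge set $\{e \setminus S : e \text{ an edge},\ S \subseteq e\}$. A sunflower with $m$ petals is a collection of $m$ distinct edges $e_1,\dots,e_m$ such that any vertex in $e_i \cap e_j$ ($i\ne j$) lies in all of them; its kernel is $\bigcap_i e_i$. For edges $e_1,\dots,e_L$, the regions $\mathcal{R}(e_1,\dots,e_L)$ are the non-empty sets $\bigcap_{i \in I} e_i \cap \bigcap_{i \in [L]\setminus I}(V(\mathcal{H}) \setminus e_i)$ for $I \subseteq [L]$. A sequence of edges $e_1,\dots,e_L$ is $k$-split-degenerate if for each $j$, $e_j$ intersects at most $k$ regions of $\mathcal{R}(e_1,\dots,e_{j-1})$ and contains no region of $\mathcal{R}(e_1,\dots,e_{j-1})$. A sequence of edges $(f_1,\dots,f_b)$ is a $b$-bromeliad if there are sets $C_i, P_i$ with $C_i, P_i$ partitioning $f_i$, $f_1 = C_1 \supsetneq C_2 \supsetneq \dots \supsetneq C_b \ne \emptyset$, and $P_1,\dots,P_b,C_1$ pairwise disjoint. A set of edges $\mathcal{H}'$ (e.g.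 the edges of a bromeliad) is $k$-compatible with a sequence $e_1,\dots,e_L$ if $e_1,\dots,e_L,e'$ is $k$-split-degenerate for every $e' \in \mathcal{H}'$. -}

module Defs where

open import Data.Nat using (ℕ; zero; suc; _≤_; _<_; _⊓_)
open import Data.Bool using (true; false)
open import Data.Fin as Fin using (Fin; fromℕ)
open import Data.Fin.Subset
  using (Subset; _∈_; _⊆_; _⊂_; _∩_; _∪_; _─_; ∁; ⋂; ∣_∣; Nonempty; ⊤; ⊥)
open import Data.Fin.Subset.Properties using (_∈?_; _⊆?_; nonempty?)
open import Data.List as List using (List; []; _∷_; length; filter; allFin; deduplicate; take; lookup; _∷ʳ_)
open import Data.List.Membership.Propositional using () renaming (_∈_ to _∈ₗ_)
open import Data.Empty using () renaming (⊥ to False)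
open import Data.List.Relation.Unary.All using (All)
open import Data.Vec using ([]; _∷_)
open import Data.Product using (Σ; ∃; ∃-syntax; _×_)
open import Relation.Binary.PropositionalEquality using (_≡_; _≢_)
open import Relation.Nullary using (¬_)
import Data.Nat.Properties as ℕP

-- Hypergraphs: vertex set V ⊆ Fin n (a finite set), edges a list of
-- subsets (the list is read as a set of edges).

record Hypergraph : Set where
  constructor hg
  field
    n : ℕ
    V : Subset n
    E : List (Subset n)
open Hypergraph public

Wf : Hypergraph → Set
Wf H = All (_⊆ V H) (E H)

elems : ∀ {n} → Subset n → List (Fin n)
elems X = filter (_∈? X) (allFin _)

numColours : ∀ {n} → Subset n → (Fin n → ℕ) → ℕ
numColours X f = length (deduplicate ℕP._≟_ (List.map f (elems X)))

Strong : (H : Hypergraph) → ℕ → (Fin (n H) → ℕ) → Set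
Strong H c f = ∀ e → e ∈ₗ E H → (c ⊓ ∣ e ∣) ≤ numColours e f

ChiAtMost : Hypergraph → ℕ → ℕ → Set
ChiAtMost H c k = ∃[ f ] (Strong H c f × numColours (V H) f ≤ k)

ChiAtLeast : Hypergraph → ℕ → ℕ → Set
ChiAtLeast H c K = ∀ f → Strong H c f → K ≤ numColours (V H) f

link : (H : Hypergraph) → Subset (n H) → Hypergraph
link H S = hg (n H) (V H ─ S) (List.map (λ e → e ─ S) (filter (S ⊆?_) (E H)))

IsSunflower : (H : Hypergraph) (m : ℕ) → (Fin m → Subset (n H)) → Set
IsSunflower H m e =
  (∀ i → e i ∈ₗ E H) ×
  (∀ i j → i ≢ j → e i ≢ e j) ×
  (∀ i j → i ≢ j → ∀ v → v ∈ e i → v ∈ e j → ∀ k → v ∈ e k)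

kernel : ∀ {N} m → (Fin m → Subset N) → Subset N
kernel m e = ⋂ (List.tabulate e)

NoSunflower : Hypergraph → (p t : ℕ) → Set
NoSunflower H p t =
  ¬ (∃[ e ] (IsSunflower H p e × ∣ kernel p e ∣ < t))

region : ∀ {N} (V : Subset N) (es : List (Subset N)) → Subset (length es) → Subset N
region V [] [] = V
region V (e ∷ es) (true ∷ I) = e ∩ region V es I
region V (e ∷ es) (false ∷ I) = ∁ e ∩ region V es I

allSubsets : ∀ L → List (Subset L)
allSubsets zero = [] ∷ []
allSubsets (suc L) =
  List.map (true ∷_) (allSubsets L) List.++ List.map (false ∷_) (allSubsets L)

regionsHit : ∀ {N} (V : Subset N) (es : List (Subset N)) → Subset N → ℕ
regionsHit V es e =
  length (filter (λ I → nonempty? (region V es I ∩ e)) (allSubsets (length es)))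

ContainsRegion : ∀ {N} (V : Subset N) (es : List (Subset N)) → Subset N → Set
ContainsRegion V es e =
  ∃[ I ] (Nonempty (region V es I) × region V es I ⊆ e)

SplitDegenerate : (H : Hypergraph) → ℕ → List (Subset (n H)) → Set
SplitDegenerate H k es =
  ∀ (j : Fin (length es)) →
    regionsHit (V H) (take (Fin.toℕ j) es) (lookup es j) ≤ k ×
    ¬ ContainsRegion (V H) (take (Fin.toℕ j) es) (lookup es j)

-- Bromeliads (b = suc b'); the sequence is f₀ … f_{b'}

record Bromeliad' (H : Hypergraph) (b' : ℕ) : Set where
  field
    f : Fin (suc b') → Subset (n H)
    C : Fin (suc b') → Subset (n H)
    P : Fin (suc b') → Subset (n H)
    f-edge : ∀ i → f i ∈ₗ E H
    part-∪ : ∀ i → C i ∪ P i ≡ f i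
    part-∩ : ∀ i → C i ∩ P i ≡ ⊥
    f₁≡C₁ : f Fin.zero ≡ C Fin.zero
    C-chain : ∀ i j → i Fin.< j → C j ⊂ C i
    C-last : Nonempty (C (fromℕ b'))
    P-disj : ∀ i j → i ≢ j → P i ∩ P j ≡ ⊥
    P-C₁-disj : ∀ i → P i ∩ C Fin.zero ≡ ⊥

Bromeliad : Hypergraph → ℕ → Set
Bromeliad H zero = False  -- b is positive; there are no 0-bromeliads
Bromeliad H (suc b') = Bromeliad' H b'

Compatible : (H : Hypergraph) (k : ℕ) (es : List (Subset (n H))) (b : ℕ) → Bromeliad H b → Set
Compatible H k es zero ()
Compatible H k es (suc b') B =
  ∀ i → SplitDegenerate H k (es ∷ʳ Bromeliad'.f B i)

{-# OPTIONS --safe #-}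
module Submission where

-- Put k = t + ℓ − 1. Relative to a list of edges, an edge meeting at least t + ℓ regions is coloured
-- strongly by the regions of its vertices, and an edge containing a region A by giving the first
-- min(t, |A|) vertices S of A private colours and colouring the rest through the link H_S (via the
-- hypothesis on t-sets if |S| = t, via the bound K_{t−|S|} otherwise). This leaves the edges compatible
-- with the list. Those meeting exactly the regions β of a list E* are handled by growing a chain
-- g₁, g₂, … among them: on every later chain edge and every edge still to be coloured, membership in gᵢ
-- depends only on the region and holds exactly on the regions γᵢ ⊆ β, and gᵢ has vertices in each region
-- of γᵢ outside every later chain edge. An edge that a new chain edge splits inside a region meets more
-- regions of the longer list and is coloured by induction on the number of regions missing; the other
-- edges are sorted by their γ, one of 2^|β| choices. After 2^|β|(b + p) + 1 steps, b + p chain edges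
-- share the same γ. If γ = ∅ they are pairwise disjoint, a sunflower with empty kernel; otherwise their
-- traces on the first one shrink strictly and their other parts are disjoint, a b-bromeliad, compatible
-- with the sequence since all chain edges are. So unless a bromeliad appears, H is coloured
-- (t + ℓ)-strongly with fewer than K₃ colours.

open import Defs
open import Data.Nat using (ℕ; zero; suc; _+_; _*_; _^_; _∸_; _≤_; _<_; _≰_; _⊓_; _⊔_; z≤n; s≤s; _≤?_; _<?_)
import Data.Nat.Properties as ℕP
open import Data.Bool as Bool using (true; false)
open import Data.Fin as Fin using (Fin)
import Data.Fin.Properties as FinP
open import Data.Vec as Vec using ([]; _∷_; here; there)
import Data.Vec.Properties as VecP
open import Data.Fin.Subset using (Subset; _∩_; _∪_; _─_; ∁; ⋂; Nonempty; _⊆_; _⊂_; ∣_∣; ⊥)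
  renaming (_∈_ to _∈ₛ_; _∉_ to _∉ₛ_)
open import Data.Fin.Subset.Properties
  using ( _∈?_; _⊆?_; nonempty?; anySubset?; Empty-unique; ∈⊤; drop-∷-⊆; ∩-idem; x∈p∩q⁺; x∈p∩q⁻; x∈p∪q⁺; x∈p∪q⁻
        ; x∉p⇒x∈∁p; x∈∁p⇒x∉p; p─q⊆p; x∈p∧x∉q⇒x∈p─q; p─q─r≡p─q∪r; p⊆q⇒∣p∣≤∣q∣; x∈p⇒∣p-x∣<∣p∣; ∣⊥∣≡0)
open import Data.List as List
  using (List; []; _∷_; _++_; _∷ʳ_; length; map; filter; take; deduplicate; tabulate; allFin; removeAt; cartesianProductWith)
open import Data.Nat.ListAction using (product)
import Data.List.Properties as ListP
open import Data.List.Properties using (length-map; length-++; length-removeAt′)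
open import Data.List.Membership.Propositional using (_∈_; find; lose)
open import Data.List.Membership.Propositional.Properties
  using ( ∈-filter⁺; ∈-filter⁻; ∈-allFin; ∈-map⁺; ∈-map⁻; ∈-++⁺ˡ; ∈-++⁺ʳ; ∈-++⁻; ∈-deduplicate⁺; ∈-deduplicate⁻
        ; ∈-cartesianProductWith⁺; ∈-lookup; ∈-length)
open import Data.List.Relation.Binary.Subset.Propositional using () renaming (_⊆_ to _⊆ₗ_)
import Data.List.Relation.Binary.Sublist.Propositional.Properties as Sublist
open import Data.List.Relation.Unary.Any as Any using (here; there; index)
open import Data.List.Relation.Unary.All as All using (All)
import Data.List.Relation.Unary.All.Properties as AllP
open import Data.List.Relation.Unary.AllPairs using (AllPairs; []; _∷_)
import Data.List.Relation.Unary.AllPairs.Properties as AllPairsP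
open import Data.List.Relation.Unary.Unique.Propositional using (Unique)
import Data.List.Relation.Unary.Unique.Propositional.Properties as Unique
open import Data.List.Relation.Unary.Unique.DecPropositional.Properties ℕP._≟_ using (deduplicate-!)
open import Data.Product as Product using (Σ; ∃; ∃-syntax; _×_; _,_; proj₁; proj₂)
open import Data.Sum as Sum using (_⊎_; inj₁; inj₂; [_,_]′)
open import Data.Empty using (⊥-elim)
open import Function using (_∘_)
open import Relation.Binary.Definitions using (DecidableEquality; tri<; tri≈; tri>)
open import Relation.Binary.PropositionalEquality
open import Relation.Nullary using (¬_; Dec; yes; no; does; ¬?; contradiction)
open import Relation.Nullary.Decidable using (_×-dec_; _→-dec_; map′)
open import Relation.Unary using (Pred; Decidable)
open import Level using (0ℓ)


sublists : ∀ {A : Set} → List A → List (List A)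
sublists []       = [] ∷ []
sublists (x ∷ xs) = map (x ∷_) (sublists xs) ++ sublists xs

module _ {A : Set} where

  ∈-removeAt⁺ : ∀ {x z : A} {ys} (x∈ys : x ∈ ys) → z ∈ ys → z ≢ x → z ∈ removeAt ys (index x∈ys)
  ∈-removeAt⁺ (here refl) (here refl) z≢x = ⊥-elim (z≢x refl)
  ∈-removeAt⁺ (here _)    (there z∈)  _   = z∈
  ∈-removeAt⁺ (there _)   (here refl) _   = here refl
  ∈-removeAt⁺ (there x∈)  (there z∈)  z≢x = there (∈-removeAt⁺ x∈ z∈ z≢x)

  unique-length-≤ : ∀ {xs ys : List A} → Unique xs → xs ⊆ₗ ys → length xs ≤ length ys
  unique-length-≤ {[]}     _              _     = z≤n
  unique-length-≤ {x ∷ xs} {ys} (x∉xs ∷ u) xs⊆ys = begin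
    suc (length xs)                          ≤⟨ s≤s (unique-length-≤ u xs⊆ys∖x) ⟩
    suc (length (removeAt ys (index x∈ys)))  ≡⟨ length-removeAt′ ys (index x∈ys) ⟨
    length ys                                ∎
    where
      open ℕP.≤-Reasoning
      x∈ys = xs⊆ys (here refl)
      xs⊆ys∖x : xs ⊆ₗ removeAt ys (index x∈ys)
      xs⊆ys∖x z∈xs = ∈-removeAt⁺ x∈ys (xs⊆ys (there z∈xs)) (λ z≡x → All.lookup x∉xs z∈xs (sym z≡x))

  length-filter+length-filter-¬ : ∀ {P : Pred A 0ℓ} (P? : Decidable P) xs →
    length (filter P? xs) + length (filter (¬? ∘ P?) xs) ≡ length xs
  length-filter+length-filter-¬ P? [] = refl
  length-filter+length-filter-¬ P? (x ∷ xs) with does (P? x)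
  ... | true  = cong suc (length-filter+length-filter-¬ P? xs)
  ... | false = trans (ℕP.+-suc _ _) (cong suc (length-filter+length-filter-¬ P? xs))

  pigeonhole : ∀ {C : Set} (colour : A → C) (_≟_ : DecidableEquality C) (Γ : List C) B xs →
    (∀ {x} → x ∈ xs → colour x ∈ Γ) → length Γ * B < length xs →
    ∃ λ γ → B < length (filter (λ x → colour x ≟ γ) xs)
  pigeonhole colour _≟_ []      B []      _     ()
  pigeonhole colour _≟_ []      B (x ∷ _) inΓ   _ with () ← inΓ (here refl)
  pigeonhole colour _≟_ (γ ∷ Γ) B xs      inΓ   lt with B <? length (filter (λ x → colour x ≟ γ) xs)
  ... | yes many = γ , many
  ... | no few   = Product.map₂ (λ {γ′} many → ℕP.<-≤-trans many (fewer γ′)) (pigeonhole colour _≟_ Γ B rest inΓ′ lt′)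
    where
      is-γ? = λ x → colour x ≟ γ
      rest = filter (¬? ∘ is-γ?) xs
      inΓ′ : ∀ {x} → x ∈ rest → colour x ∈ Γ
      inΓ′ x∈ with ∈-filter⁻ (¬? ∘ is-γ?) {xs = xs} x∈
      ... | x∈xs , ≢γ with inΓ x∈xs
      ...   | here ≡γ = ⊥-elim (≢γ ≡γ)
      ...   | there ∈Γ = ∈Γ
      lt′ : length Γ * B < length rest
      lt′ = ℕP.+-cancelˡ-< B _ _ (begin-strict
        B + length Γ * B                       <⟨ lt ⟩
        length xs                              ≡⟨ length-filter+length-filter-¬ is-γ? xs ⟨
        length (filter is-γ? xs) + length rest ≤⟨ ℕP.+-monoˡ-≤ _ (ℕP.≮⇒≥ few) ⟩
        B + length rest                        ∎)
        where open ℕP.≤-Reasoning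
      fewer : ∀ γ′ → length (filter (λ x → colour x ≟ γ′) rest) ≤ length (filter (λ x → colour x ≟ γ′) xs)
      fewer γ′ = Sublist.length-mono-≤ (Sublist.filter⁺ _ _ (λ { refl p → p }) (Sublist.filter-⊆ (¬? ∘ is-γ?) xs))

  filter∈sublists : ∀ {P : Pred A 0ℓ} (P? : Decidable P) xs → filter P? xs ∈ sublists xs
  filter∈sublists P? []       = here refl
  filter∈sublists P? (x ∷ xs) with does (P? x)
  ... | true  = ∈-++⁺ˡ (∈-map⁺ (x ∷_) (filter∈sublists P? xs))
  ... | false = ∈-++⁺ʳ (map (x ∷_) (sublists xs)) (filter∈sublists P? xs)

  ∈-sublists⇒⊆ : ∀ {ys : List A} xs → ys ∈ sublists xs → ys ⊆ₗ xs
  ∈-sublists⇒⊆ []       (here refl) ()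
  ∈-sublists⇒⊆ (x ∷ xs) ys∈ with ∈-++⁻ (map (x ∷_) (sublists xs)) ys∈
  ... | inj₂ ys∈′ = there ∘ ∈-sublists⇒⊆ xs ys∈′
  ... | inj₁ ys∈′ with ∈-map⁻ (x ∷_) ys∈′
  ...   | zs , zs∈ , refl = λ { (here refl) → here refl ; (there z∈) → there (∈-sublists⇒⊆ xs zs∈ z∈) }

  length-sublists : ∀ (xs : List A) → length (sublists xs) ≡ 2 ^ length xs
  length-sublists []       = refl
  length-sublists (x ∷ xs) = begin
    length (map (x ∷_) (sublists xs) ++ sublists xs)
      ≡⟨ length-++ (map (x ∷_) (sublists xs)) ⟩
    length (map (x ∷_) (sublists xs)) + length (sublists xs)
      ≡⟨ cong (_+ length (sublists xs)) (length-map (x ∷_) (sublists xs)) ⟩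
    length (sublists xs) + length (sublists xs)
      ≡⟨ cong (λ m → m + m) (length-sublists xs) ⟩
    2 ^ length xs + 2 ^ length xs
      ≡⟨ cong (2 ^ length xs +_) (sym (ℕP.+-identityʳ (2 ^ length xs))) ⟩
    2 ^ length (x ∷ xs)
      ∎
    where open ≡-Reasoning

  nonempty-list : ∀ {xs : List A} → 1 ≤ length xs → ∃ λ x → x ∈ xs
  nonempty-list {x ∷ _} _ = x , here refl

  AllPairs-lookup : ∀ {R : A → A → Set} {xs} → AllPairs R xs →
    ∀ {i j : Fin (length xs)} → Fin.toℕ i < Fin.toℕ j → R (List.lookup xs i) (List.lookup xs j)
  AllPairs-lookup (Rx ∷ _)   {Fin.zero}  {Fin.suc j} _         = All.lookup Rx (∈-lookup j)
  AllPairs-lookup (_ ∷ Rxs) {Fin.suc i} {Fin.suc j} (s≤s i<j) = AllPairs-lookup Rxs i<j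

  AllPairs-sample : ∀ {R : A → A → Set} {xs} m → m ≤ length xs → AllPairs R xs →
    Σ (Fin m → A) λ x → (∀ i → x i ∈ xs) × (∀ {i j} → i Fin.< j → R (x j) (x i))
  AllPairs-sample {xs = xs} m m≤ R-xs = List.lookup xs ∘ position , ∈-lookup ∘ position , λ {i} {j} i<j →
    AllPairs-lookup R-xs (subst₂ _<_ (sym (FinP.toℕ-fromℕ< _)) (sym (FinP.toℕ-fromℕ< _))
                                     (ℕP.∸-monoʳ-< (s≤s i<j) (FinP.toℕ<n j)))
    where
      position : Fin m → Fin (length xs)
      position i = Fin.fromℕ< (ℕP.<-≤-trans (ℕP.∸-monoʳ-< {m} {suc (Fin.toℕ i)} {0} (s≤s z≤n) (FinP.toℕ<n i)) m≤)

length-cartesianProductWith : ∀ {A B C : Set} (f : A → B → C) xs ys →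
  length (cartesianProductWith f xs ys) ≡ length xs * length ys
length-cartesianProductWith f []       ys = refl
length-cartesianProductWith f (x ∷ xs) ys = begin
  length (map (f x) ys ++ cartesianProductWith f xs ys)
    ≡⟨ length-++ (map (f x) ys) ⟩
  length (map (f x) ys) + length (cartesianProductWith f xs ys)
    ≡⟨ cong₂ _+_ (length-map (f x) ys) (length-cartesianProductWith f xs ys) ⟩
  length ys + length xs * length ys
    ∎
  where open ≡-Reasoning

inj₁-or-all-inj₂ : ∀ {I R : Set} {C : I → Set} (is : List I) → (∀ {i} → i ∈ is → R ⊎ C i) → R ⊎ (∀ {i} → i ∈ is → C i)
inj₁-or-all-inj₂ []       _      = inj₂ λ ()
inj₁-or-all-inj₂ (i ∷ is) R⊎C with R⊎C (here refl) | inj₁-or-all-inj₂ is (R⊎C ∘ there)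
... | inj₁ r  | _        = inj₁ r
... | inj₂ _  | inj₁ r   = inj₁ r
... | inj₂ Ci | inj₂ Cis = inj₂ λ { (here refl) → Ci ; (there i∈) → Cis i∈ }

product-map-const : ∀ {I : Set} K (is : List I) → product (map (λ _ → K) is) ≡ K ^ length is
product-map-const K []       = refl
product-map-const K (_ ∷ is) = cong (K *_) (product-map-const K is)


1≤^ : ∀ {a} e → 1 ≤ a → 1 ≤ a ^ e
1≤^ {a} e a≥1 = subst (_≤ a ^ e) (ℕP.^-zeroˡ e) (ℕP.^-monoˡ-≤ e a≥1)

1≤product : ∀ {xs} → All (1 ≤_) xs → 1 ≤ product xs
1≤product All.[]         = ℕP.≤-refl
1≤product (x≥1 All.∷ xs≥1) = ℕP.*-mono-≤ x≥1 (1≤product xs≥1)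

+-⊓-∸ : ∀ {s t} ℓ a → s ≤ t → (t + ℓ) ⊓ (a + s) ≡ s + ((t ∸ s + ℓ) ⊓ a)
+-⊓-∸ {s} {t} ℓ a s≤t = sym (begin
  s + ((t ∸ s + ℓ) ⊓ a)         ≡⟨ ℕP.+-distribˡ-⊓ s (t ∸ s + ℓ) a ⟩
  (s + (t ∸ s + ℓ)) ⊓ (s + a)   ≡⟨ cong₂ _⊓_ (sym (ℕP.+-assoc s (t ∸ s) ℓ)) (ℕP.+-comm s a) ⟩
  (s + (t ∸ s) + ℓ) ⊓ (a + s)   ≡⟨ cong (λ m → (m + ℓ) ⊓ (a + s)) (ℕP.m+[n∸m]≡n s≤t) ⟩
  (t + ℓ) ⊓ (a + s)             ∎)
  where open ≡-Reasoning

1≤-summand : ∀ {k a r} → k < a + r → a ≤ k → 1 ≤ r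
1≤-summand {k} {a} {zero}  k< a≤k = ⊥-elim (ℕP.<⇒≱ k< (subst (_≤ k) (sym (ℕP.+-identityʳ a)) a≤k))
1≤-summand {r = suc r}     _  _   = s≤s z≤n

common-bound : ∀ {P : ℕ → ℕ → Set} → (∀ {i K K′} → K ≤ K′ → P i K → P i K′) →
  ∀ t → (∀ i → i < t → ∃ (P i)) → ∃ λ K → ∀ i → i < t → P i K
common-bound         mono zero    _      = 0 , λ _ ()
common-bound {P = P} mono (suc t) bounds = K ⊔ Kₜ , below
  where
    below-t : ∃ λ K → ∀ i → i < t → P i K
    below-t = common-bound mono t (λ i i<t → bounds i (ℕP.m<n⇒m<1+n i<t))
    K = proj₁ below-t
    Kₜ = proj₁ (bounds t ℕP.≤-refl)
    below : ∀ i → i < suc t → P i (K ⊔ Kₜ)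
    below i i<1+t with ℕP.m<1+n⇒m<n∨m≡n i<1+t
    ... | inj₁ i<t  = mono (ℕP.m≤m⊔n K Kₜ) (proj₂ below-t i i<t)
    ... | inj₂ refl = mono (ℕP.m≤n⊔m K Kₜ) (proj₂ (bounds t ℕP.≤-refl))

-- pair a b = 2 ^ a * (2 * b + 1)
pair : ℕ → ℕ → ℕ
pair zero    b = suc (2 * b)
pair (suc a) b = 2 * pair a b

pair-injective : ∀ a b a′ b′ → pair a b ≡ pair a′ b′ → a ≡ a′ × b ≡ b′
pair-injective zero    b zero     b′ eq = refl , ℕP.*-cancelˡ-≡ b b′ 2 (ℕP.suc-injective eq)
pair-injective zero    b (suc a′) b′ eq = ⊥-elim (ℕP.even≢odd (pair a′ b′) b (sym eq))
pair-injective (suc a) b zero     b′ eq = ⊥-elim (ℕP.even≢odd (pair a b) b′ eq)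
pair-injective (suc a) b (suc a′) b′ eq =
  Product.map₁ (cong suc) (pair-injective a b a′ b′ (ℕP.*-cancelˡ-≡ (pair a b) (pair a′ b′) 2 eq))


_≟ₛ_ : ∀ {L} → DecidableEquality (Subset L)
_≟ₛ_ = VecP.≡-dec Bool._≟_

_≟ₗ_ : ∀ {L} → DecidableEquality (List (Subset L))
_≟ₗ_ = ListP.≡-dec _≟ₛ_

_∈ₗ?_ : ∀ {L} (I : Subset L) (Is : List (Subset L)) → Dec (I ∈ Is)
I ∈ₗ? Is = Any.any? (I ≟ₛ_) Is

module _ {N : ℕ} where

  x∈p─q⁻ : ∀ {x : Fin N} (p q : Subset N) → x ∈ₛ p ─ q → x ∈ₛ p × x ∉ₛ q
  x∈p─q⁻ p q x∈ = p─q⊆p p q x∈ , λ x∈q → x∉p─q p q x∈q x∈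
    where
      x∉p─q : ∀ {M} {x : Fin M} (p q : Subset M) → x ∈ₛ q → x ∉ₛ p ─ q
      x∉p─q (_ ∷ p) (true ∷ q)  here       ()
      x∉p─q (_ ∷ p) (_ ∷ q)     (there x∈q) (there x∈) = x∉p─q p q x∈q x∈

  x∈⋂⁻ : ∀ {x : Fin N} (ps : List (Subset N)) → x ∈ₛ ⋂ ps → All (x ∈ₛ_) ps
  x∈⋂⁻ []       _  = All.[]
  x∈⋂⁻ (p ∷ ps) x∈ = let (x∈p , x∈⋂ps) = x∈p∩q⁻ p (⋂ ps) x∈ in x∈p All.∷ x∈⋂⁻ ps x∈⋂ps

  x∈⋂⁺ : ∀ {x : Fin N} (ps : List (Subset N)) → All (x ∈ₛ_) ps → x ∈ₛ ⋂ ps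
  x∈⋂⁺ []       _               = ∈⊤
  x∈⋂⁺ (p ∷ ps) (x∈p All.∷ x∈ps) = x∈p∩q⁺ (x∈p , x∈⋂⁺ ps x∈ps)

  disjoint⇒∩≡⊥ : ∀ {p q : Subset N} → (∀ {v} → v ∈ₛ p → v ∉ₛ q) → p ∩ q ≡ ⊥
  disjoint⇒∩≡⊥ {p} {q} disjoint = Empty-unique λ (v , v∈) → let (v∈p , v∈q) = x∈p∩q⁻ p q v∈ in disjoint v∈p v∈q

  p∩q∪p─q≡p : ∀ (p q : Subset N) → (p ∩ q) ∪ (p ─ q) ≡ p
  p∩q∪p─q≡p p q = go p q
    where
      go : ∀ {M} (p q : Subset M) → (p ∩ q) ∪ (p ─ q) ≡ p
      go []          []          = refl
      go (true ∷ p)  (true ∷ q)  = cong (true ∷_) (go p q)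
      go (true ∷ p)  (false ∷ q) = cong (true ∷_) (go p q)
      go (false ∷ p) (true ∷ q)  = cong (false ∷_) (go p q)
      go (false ∷ p) (false ∷ q) = cong (false ∷_) (go p q)

  ∃∈? : ∀ {P : Fin N → Set} → Decidable P → (X : Subset N) → Dec (∃ λ v → v ∈ₛ X × P v)
  ∃∈? P? X = FinP.any? λ v → (v ∈? X) ×-dec P? v

  ∀∈? : ∀ {P : Fin N → Set} → Decidable P → (X : Subset N) → Dec (∀ {v} → v ∈ₛ X → P v)
  ∀∈? P? X = map′ (λ all {v} → all v) (λ all v → all) (FinP.all? λ v → (v ∈? X) →-dec P? v)

∣p─q∣+∣q∣≡∣p∣ : ∀ {N} (p q : Subset N) → q ⊆ p → ∣ p ─ q ∣ + ∣ q ∣ ≡ ∣ p ∣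
∣p─q∣+∣q∣≡∣p∣ []           []           _   = refl
∣p─q∣+∣q∣≡∣p∣ (true ∷ p)   (true ∷ q)   q⊆p = trans (ℕP.+-suc _ _) (cong suc (∣p─q∣+∣q∣≡∣p∣ p q (drop-∷-⊆ q⊆p)))
∣p─q∣+∣q∣≡∣p∣ (true ∷ p)   (false ∷ q)  q⊆p = cong suc (∣p─q∣+∣q∣≡∣p∣ p q (drop-∷-⊆ q⊆p))
∣p─q∣+∣q∣≡∣p∣ (false ∷ p)  (false ∷ q)  q⊆p = ∣p─q∣+∣q∣≡∣p∣ p q (drop-∷-⊆ q⊆p)
∣p─q∣+∣q∣≡∣p∣ (false ∷ p)  (true ∷ q)   q⊆p with () ← q⊆p here

∣p∪q∣≡∣p∣+∣q∣ : ∀ {N} (p q : Subset N) → (∀ {x} → x ∈ₛ p → x ∉ₛ q) → ∣ p ∪ q ∣ ≡ ∣ p ∣ + ∣ q ∣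
∣p∪q∣≡∣p∣+∣q∣ []          []          _        = refl
∣p∪q∣≡∣p∣+∣q∣ (true ∷ p)  (true ∷ q)  disjoint with () ← disjoint here here
∣p∪q∣≡∣p∣+∣q∣ (true ∷ p)  (false ∷ q) disjoint = cong suc (∣p∪q∣≡∣p∣+∣q∣ p q λ x∈p x∈q → disjoint (there x∈p) (there x∈q))
∣p∪q∣≡∣p∣+∣q∣ (false ∷ p) (true ∷ q)  disjoint =
  trans (cong suc (∣p∪q∣≡∣p∣+∣q∣ p q λ x∈p x∈q → disjoint (there x∈p) (there x∈q))) (sym (ℕP.+-suc _ _))
∣p∪q∣≡∣p∣+∣q∣ (false ∷ p) (false ∷ q) disjoint = ∣p∪q∣≡∣p∣+∣q∣ p q λ x∈p x∈q → disjoint (there x∈p) (there x∈q)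

∣p∪q∣≤∣p∣+∣q∣ : ∀ {N} (p q : Subset N) → ∣ p ∪ q ∣ ≤ ∣ p ∣ + ∣ q ∣
∣p∪q∣≤∣p∣+∣q∣ []          []          = z≤n
∣p∪q∣≤∣p∣+∣q∣ (true ∷ p)  (true ∷ q)  = s≤s (ℕP.≤-trans (∣p∪q∣≤∣p∣+∣q∣ p q) (ℕP.+-monoʳ-≤ ∣ p ∣ (ℕP.n≤1+n ∣ q ∣)))
∣p∪q∣≤∣p∣+∣q∣ (true ∷ p)  (false ∷ q) = s≤s (∣p∪q∣≤∣p∣+∣q∣ p q)
∣p∪q∣≤∣p∣+∣q∣ (false ∷ p) (true ∷ q)  = ℕP.≤-trans (s≤s (∣p∪q∣≤∣p∣+∣q∣ p q)) (ℕP.≤-reflexive (sym (ℕP.+-suc _ _)))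
∣p∪q∣≤∣p∣+∣q∣ (false ∷ p) (false ∷ q) = ∣p∪q∣≤∣p∣+∣q∣ p q

takeSubset : ∀ {N} → ℕ → Subset N → Subset N
takeSubset k       []          = []
takeSubset zero    (_ ∷ X)     = false ∷ takeSubset zero X
takeSubset (suc k) (true ∷ X)  = true ∷ takeSubset k X
takeSubset (suc k) (false ∷ X) = false ∷ takeSubset (suc k) X

takeSubset-⊆ : ∀ {N} k (X : Subset N) → takeSubset k X ⊆ X
takeSubset-⊆ zero    (_ ∷ X)     (there x∈) = there (takeSubset-⊆ zero X x∈)
takeSubset-⊆ (suc k) (true ∷ X)  here       = here
takeSubset-⊆ (suc k) (true ∷ X)  (there x∈) = there (takeSubset-⊆ k X x∈)
takeSubset-⊆ (suc k) (false ∷ X) (there x∈) = there (takeSubset-⊆ (suc k) X x∈)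

∣takeSubset∣ : ∀ {N} k (X : Subset N) → ∣ takeSubset k X ∣ ≡ k ⊓ ∣ X ∣
∣takeSubset∣ k       []          = sym (ℕP.⊓-zeroʳ k)
∣takeSubset∣ zero    (_ ∷ X)     = ∣takeSubset∣ zero X
∣takeSubset∣ (suc k) (true ∷ X)  = cong suc (∣takeSubset∣ k X)
∣takeSubset∣ (suc k) (false ∷ X) = ∣takeSubset∣ (suc k) X

module _ {N : ℕ} {p : ℕ} {e : Fin p → Subset N} {x : Fin N} where

  ∈-kernel⁺ : (∀ i → x ∈ₛ e i) → x ∈ₛ kernel p e
  ∈-kernel⁺ x∈e = x∈⋂⁺ (tabulate e) (AllP.tabulate⁺ x∈e)

  ∈-kernel⁻ : x ∈ₛ kernel p e → ∀ i → x ∈ₛ e i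
  ∈-kernel⁻ x∈ = AllP.tabulate⁻ (x∈⋂⁻ (tabulate e) x∈)


-- Counting colours

module _ {N : ℕ} where

  ∈-elems⁺ : ∀ {X : Subset N} {v} → v ∈ₛ X → v ∈ elems X
  ∈-elems⁺ {X} {v} v∈X = ∈-filter⁺ (_∈? X) (∈-allFin v) v∈X

  ∈-elems⁻ : ∀ {X : Subset N} {v} → v ∈ elems X → v ∈ₛ X
  ∈-elems⁻ {X} v∈ = proj₂ (∈-filter⁻ (_∈? X) {xs = allFin N} v∈)

  elems-unique : ∀ (X : Subset N) → Unique (elems X)
  elems-unique X = Unique.filter⁺ (_∈? X) (Unique.allFin⁺ N)

length-filter-∈?-tabulate : ∀ {m n} (X : Subset n) (Y : Subset m) (f : Fin n → Fin m) →
  (∀ i → does (f i ∈? Y) ≡ does (i ∈? X)) → length (filter (_∈? Y) (tabulate f)) ≡ ∣ X ∣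
length-filter-∈?-tabulate []      Y f same = refl
length-filter-∈?-tabulate (b ∷ X) Y f same
  with b | does (f Fin.zero ∈? Y) | same Fin.zero | length-filter-∈?-tabulate X Y (f ∘ Fin.suc) (same ∘ Fin.suc)
... | true  | true  | _ | ih = cong suc ih
... | false | false | _ | ih = ih

length-elems : ∀ {N} (X : Subset N) → length (elems X) ≡ ∣ X ∣
length-elems X = length-filter-∈?-tabulate X X (λ i → i) (λ _ → refl)

module _ {N : ℕ} (X : Subset N) where

  numColours≤length : ∀ (f : Fin N → ℕ) ys → (∀ {v} → v ∈ₛ X → f v ∈ ys) → numColours X f ≤ length ys
  numColours≤length f ys cover = unique-length-≤ (deduplicate-! _) λ z∈ →
    let (v , v∈ , z≡fv) = ∈-map⁻ f (∈-deduplicate⁻ ℕP._≟_ _ z∈)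
    in subst (_∈ ys) (sym z≡fv) (cover (∈-elems⁻ v∈))

  length≤numColours : ∀ (f : Fin N → ℕ) zs → Unique zs →
    (∀ {z} → z ∈ zs → ∃ λ v → v ∈ₛ X × f v ≡ z) → length zs ≤ numColours X f
  length≤numColours f zs u attained = unique-length-≤ u λ z∈ →
    let (v , v∈X , fv≡z) = attained z∈
    in ∈-deduplicate⁺ ℕP._≟_ (subst (_∈ map f (elems X)) fv≡z (∈-map⁺ f (∈-elems⁺ v∈X)))

  colours : (Fin N → ℕ) → List ℕ
  colours F = deduplicate ℕP._≟_ (map F (elems X))

  ∈-colours : ∀ F {v} → v ∈ₛ X → F v ∈ colours F
  ∈-colours F v∈X = ∈-deduplicate⁺ ℕP._≟_ (∈-map⁺ F (∈-elems⁺ v∈X))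

  ∈-colours⁻ : ∀ F {z} → z ∈ colours F → ∃ λ v → v ∈ₛ X × F v ≡ z
  ∈-colours⁻ F z∈ = let (v , v∈ , z≡Fv) = ∈-map⁻ F (∈-deduplicate⁻ ℕP._≟_ _ z∈) in v , ∈-elems⁻ v∈ , sym z≡Fv

  module Factor (f F : Fin N → ℕ) (fibre : ∀ {v w} → v ∈ₛ X → w ∈ₛ X → F v ≡ F w → f v ≡ f w) where

    φ : ℕ → ℕ
    φ z with Any.any? (λ v → F v ℕP.≟ z) (elems X)
    ... | yes hit = f (proj₁ (find hit))
    ... | no  _   = 0

    φ∘F : ∀ {v} → v ∈ₛ X → φ (F v) ≡ f v
    φ∘F {v} v∈X with Any.any? (λ w → F w ℕP.≟ F v) (elems X)
    ... | yes hit = let (w , w∈ , Fw≡Fv) = find hit in fibre (∈-elems⁻ w∈) v∈X Fw≡Fv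
    ... | no miss = ⊥-elim (miss (lose (∈-elems⁺ v∈X) refl))

    numColours-factor : numColours X f ≤ numColours X F
    numColours-factor = begin
      numColours X f             ≤⟨ numColours≤length f (map φ (colours F)) cover ⟩
      length (map φ (colours F)) ≡⟨ length-map φ (colours F) ⟩
      numColours X F             ∎
      where
        open ℕP.≤-Reasoning
        cover : ∀ {v} → v ∈ₛ X → f v ∈ map φ (colours F)
        cover v∈X = subst (_∈ map φ (colours F)) (φ∘F v∈X) (∈-map⁺ φ (∈-colours F v∈X))

    numColours-factor-< : ∀ {v w} → v ∈ₛ X → w ∈ₛ X → f v ≡ f w → F v ≢ F w → numColours X f < numColours X F
    numColours-factor-< {v} {w} v∈X w∈X fv≡fw Fv≢Fw = begin-strict
      numColours X f              ≤⟨ numColours≤length f (map φ others) cover ⟩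
      length (map φ others)       ≡⟨ length-map φ others ⟩
      length others               <⟨ ℕP.n<1+n _ ⟩
      suc (length others)         ≡⟨ length-removeAt′ (colours F) (index Fw∈) ⟨
      numColours X F              ∎
      where
        open ℕP.≤-Reasoning
        Fw∈ = ∈-colours F w∈X
        others = removeAt (colours F) (index Fw∈)
        cover : ∀ {u} → u ∈ₛ X → f u ∈ map φ others
        cover {u} u∈X with F u ℕP.≟ F w
        ... | no Fu≢Fw = subst (_∈ map φ others) (φ∘F u∈X) (∈-map⁺ φ (∈-removeAt⁺ Fw∈ (∈-colours F u∈X) Fu≢Fw))
        ... | yes Fu≡Fw = subst (_∈ map φ others) (trans (φ∘F v∈X) (trans fv≡fw (sym (fibre u∈X w∈X Fu≡Fw))))
                            (∈-map⁺ φ (∈-removeAt⁺ Fw∈ (∈-colours F v∈X) Fv≢Fw))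

  numColours-pair≤* : ∀ (f g : Fin N → ℕ) → numColours X (λ v → pair (f v) (g v)) ≤ numColours X f * numColours X g
  numColours-pair≤* f g = begin
    numColours X (λ v → pair (f v) (g v))                      ≤⟨ numColours≤length _ pairs cover ⟩
    length pairs                                               ≡⟨ length-cartesianProductWith pair (colours f) (colours g) ⟩
    numColours X f * numColours X g                            ∎
    where
      open ℕP.≤-Reasoning
      pairs = cartesianProductWith pair (colours f) (colours g)
      cover : ∀ {v} → v ∈ₛ X → pair (f v) (g v) ∈ pairs
      cover v∈X = ∈-cartesianProductWith⁺ pair (∈-colours f v∈X) (∈-colours g v∈X)

  numColours≤numColours-pairˡ : ∀ (f g : Fin N → ℕ) → numColours X f ≤ numColours X (λ v → pair (f v) (g v))
  numColours≤numColours-pairˡ f g =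
    Factor.numColours-factor f _ (λ {v} {w} _ _ → proj₁ ∘ pair-injective (f v) (g v) (f w) (g w))

  numColours≤numColours-pairʳ : ∀ (f g : Fin N → ℕ) → numColours X g ≤ numColours X (λ v → pair (f v) (g v))
  numColours≤numColours-pairʳ f g =
    Factor.numColours-factor g _ (λ {v} {w} _ _ → proj₂ ∘ pair-injective (f v) (g v) (f w) (g w))

  numColours-const≤1 : ∀ c → numColours X (λ _ → c) ≤ 1
  numColours-const≤1 c = numColours≤length _ (c ∷ []) (λ _ → here refl)

module _ {N : ℕ} (S : Subset N) (g : Fin N → ℕ) where

  separate : Fin N → ℕ
  separate v with v ∈? S
  ... | yes _ = pair 1 (Fin.toℕ v)
  ... | no  _ = pair 0 (g v)

  separate-∈ : ∀ {v} → v ∈ₛ S → separate v ≡ pair 1 (Fin.toℕ v)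
  separate-∈ {v} v∈S with v ∈? S
  ... | yes _   = refl
  ... | no v∉S = ⊥-elim (v∉S v∈S)

  separate-∉ : ∀ {v} → v ∉ₛ S → separate v ≡ pair 0 (g v)
  separate-∉ {v} v∉S with v ∈? S
  ... | yes v∈S = ⊥-elim (v∉S v∈S)
  ... | no _    = refl

  separateColours : Subset N → List ℕ
  separateColours X = map (pair 1 ∘ Fin.toℕ) (elems S) ++ map (pair 0) (colours (X ─ S) g)

  length-separateColours : ∀ X → length (separateColours X) ≡ ∣ S ∣ + numColours (X ─ S) g
  length-separateColours X = trans (length-++ (map (pair 1 ∘ Fin.toℕ) (elems S)))
    (cong₂ _+_ (trans (length-map _ (elems S)) (length-elems S)) (length-map (pair 0) (colours (X ─ S) g)))

  numColours-separate≤ : ∀ X → numColours X separate ≤ ∣ S ∣ + numColours (X ─ S) g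
  numColours-separate≤ X =
    ℕP.≤-trans (numColours≤length X separate (separateColours X) cover) (ℕP.≤-reflexive (length-separateColours X))
    where
      cover : ∀ {v} → v ∈ₛ X → separate v ∈ separateColours X
      cover {v} v∈X with v ∈? S
      ... | yes v∈S = ∈-++⁺ˡ (∈-map⁺ (pair 1 ∘ Fin.toℕ) (∈-elems⁺ v∈S))
      ... | no v∉S  = ∈-++⁺ʳ _ (∈-map⁺ (pair 0) (∈-colours (X ─ S) g (x∈p∧x∉q⇒x∈p─q v∈X v∉S)))

  ≤numColours-separate : ∀ X → S ⊆ X → ∣ S ∣ + numColours (X ─ S) g ≤ numColours X separate
  ≤numColours-separate X S⊆X = ℕP.≤-trans (ℕP.≤-reflexive (sym (length-separateColours X)))
    (length≤numColours X separate (separateColours X) unique attained)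
    where
      unique : Unique (separateColours X)
      unique = Unique.++⁺
        (Unique.map⁺ (λ {v} {w} eq → FinP.toℕ-injective (proj₂ (pair-injective 1 (Fin.toℕ v) 1 (Fin.toℕ w) eq)))
                     (elems-unique S))
        (Unique.map⁺ (λ {x} {y} eq → proj₂ (pair-injective 0 x 0 y eq)) (deduplicate-! _))
        λ (in₁ , in₀) → let (v , _ , z≡₁) = ∈-map⁻ (pair 1 ∘ Fin.toℕ) in₁ ; (y , _ , z≡₀) = ∈-map⁻ (pair 0) in₀
                        in ℕP.1+n≢0 (proj₁ (pair-injective 1 (Fin.toℕ v) 0 y (trans (sym z≡₁) z≡₀)))
      attained : ∀ {z} → z ∈ separateColours X → ∃ λ v → v ∈ₛ X × separate v ≡ z
      attained z∈ with ∈-++⁻ (map (pair 1 ∘ Fin.toℕ) (elems S)) z∈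
      ... | inj₁ in₁ = let (v , v∈ , z≡) = ∈-map⁻ (pair 1 ∘ Fin.toℕ) in₁ ; v∈S = ∈-elems⁻ v∈
                       in v , S⊆X v∈S , trans (separate-∈ v∈S) (sym z≡)
      ... | inj₂ in₀ = let (y , y∈ , z≡) = ∈-map⁻ (pair 0) in₀ ; (w , w∈X─S , gw≡y) = ∈-colours⁻ (X ─ S) g y∈
                           (w∈X , w∉S) = x∈p─q⁻ X S w∈X─S
                       in w , w∈X , trans (separate-∉ w∉S) (trans (cong (pair 0) gw≡y) (sym z≡))


-- Regions and signatures

encode : ∀ {L} → Subset L → ℕ
encode []          = 0
encode (false ∷ I) = pair 0 (encode I)
encode (true ∷ I)  = pair 1 (encode I)

encode-injective : ∀ {L} {I J : Subset L} → encode I ≡ encode J → I ≡ J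
encode-injective {I = []}        {[]}        _  = refl
encode-injective {I = false ∷ I} {false ∷ J} eq =
  cong (false ∷_) (encode-injective (proj₂ (pair-injective 0 (encode I) 0 (encode J) eq)))
encode-injective {I = true ∷ I}  {true ∷ J}  eq =
  cong (true ∷_) (encode-injective (proj₂ (pair-injective 1 (encode I) 1 (encode J) eq)))
encode-injective {I = false ∷ I} {true ∷ J}  eq with () ← proj₁ (pair-injective 0 (encode I) 1 (encode J) eq)
encode-injective {I = true ∷ I}  {false ∷ J} eq with () ← proj₁ (pair-injective 1 (encode I) 0 (encode J) eq)

∈-allSubsets : ∀ {L} (I : Subset L) → I ∈ allSubsets L
∈-allSubsets []                 = here refl
∈-allSubsets {suc L} (true ∷ I)  = ∈-++⁺ˡ (∈-map⁺ (true ∷_) (∈-allSubsets I))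
∈-allSubsets {suc L} (false ∷ I) = ∈-++⁺ʳ (map (true ∷_) (allSubsets L)) (∈-map⁺ (false ∷_) (∈-allSubsets I))

allSubsets-unique : ∀ L → Unique (allSubsets L)
allSubsets-unique zero    = All.[] ∷ []
allSubsets-unique (suc L) =
  Unique.++⁺ (Unique.map⁺ VecP.∷-injectiveʳ (allSubsets-unique L)) (Unique.map⁺ VecP.∷-injectiveʳ (allSubsets-unique L))
    λ (in-true , in-false) →
      let (_ , _ , ≡true∷) = ∈-map⁻ (true ∷_) in-true ; (_ , _ , ≡false∷) = ∈-map⁻ (false ∷_) in-false
      in contradiction (VecP.∷-injectiveˡ (trans (sym ≡true∷) ≡false∷)) λ ()

length-allSubsets : ∀ L → length (allSubsets L) ≡ 2 ^ L
length-allSubsets zero    = refl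
length-allSubsets (suc L) = begin
  length (map (true ∷_) (allSubsets L) ++ map (false ∷_) (allSubsets L))
    ≡⟨ length-++ (map (true ∷_) (allSubsets L)) ⟩
  length (map (true ∷_) (allSubsets L)) + length (map (false ∷_) (allSubsets L))
    ≡⟨ cong₂ _+_ (length-map _ (allSubsets L)) (length-map _ (allSubsets L)) ⟩
  length (allSubsets L) + length (allSubsets L)
    ≡⟨ cong (λ m → m + m) (length-allSubsets L) ⟩
  2 ^ L + 2 ^ L
    ≡⟨ cong (2 ^ L +_) (sym (ℕP.+-identityʳ (2 ^ L))) ⟩
  2 ^ suc L
    ∎
  where open ≡-Reasoning

module _ {N : ℕ} where

  ∈⇒lookup : ∀ {v} {e : Subset N} → v ∈ₛ e → Vec.lookup e v ≡ true
  ∈⇒lookup = VecP.[]=⇒lookup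

  lookup⇒∈ : ∀ {v} {e : Subset N} → Vec.lookup e v ≡ true → v ∈ₛ e
  lookup⇒∈ {v} {e} = VecP.lookup⇒[]= v e

  ∉⇒lookup : ∀ {v} {e : Subset N} → v ∉ₛ e → Vec.lookup e v ≡ false
  ∉⇒lookup {v} {e} v∉e with Vec.lookup e v in eq
  ... | true  = ⊥-elim (v∉e (lookup⇒∈ eq))
  ... | false = refl

  lookup⇒∉ : ∀ {v} {e : Subset N} → Vec.lookup e v ≡ false → v ∉ₛ e
  lookup⇒∉ eq v∈e with () ← trans (sym (∈⇒lookup v∈e)) eq

  signature : (es : List (Subset N)) → Fin N → Subset (length es)
  signature []       v = []
  signature (e ∷ es) v = Vec.lookup e v ∷ signature es v

  regionColour : List (Subset N) → Fin N → ℕ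
  regionColour es = encode ∘ signature es

  ∈-region-signature : ∀ (V : Subset N) es {v} → v ∈ₛ V → v ∈ₛ region V es (signature es v)
  ∈-region-signature V []       v∈V = v∈V
  ∈-region-signature V (e ∷ es) {v} v∈V with Vec.lookup e v in eq
  ... | true  = x∈p∩q⁺ (lookup⇒∈ eq , ∈-region-signature V es v∈V)
  ... | false = x∈p∩q⁺ (x∉p⇒x∈∁p (lookup⇒∉ eq) , ∈-region-signature V es v∈V)

  ∈-region⁻ : ∀ (V : Subset N) es I {v} → v ∈ₛ region V es I → v ∈ₛ V × signature es v ≡ I
  ∈-region⁻ V []       []          v∈ = v∈ , refl
  ∈-region⁻ V (e ∷ es) (true ∷ I)  v∈ =
    let (v∈e , v∈R) = x∈p∩q⁻ e _ v∈ in Product.map₂ (cong₂ _∷_ (∈⇒lookup v∈e)) (∈-region⁻ V es I v∈R)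
  ∈-region⁻ V (e ∷ es) (false ∷ I) v∈ =
    let (v∈∁e , v∈R) = x∈p∩q⁻ (∁ e) _ v∈ in Product.map₂ (cong₂ _∷_ (∉⇒lookup (x∈∁p⇒x∉p v∈∁e))) (∈-region⁻ V es I v∈R)

  regionsMet : (V : Subset N) (es : List (Subset N)) → Subset N → List (Subset (length es))
  regionsMet V es h = filter (λ I → nonempty? (region V es I ∩ h)) (allSubsets (length es))

  regionsMet-unique : ∀ V es h → Unique (regionsMet V es h)
  regionsMet-unique V es h = Unique.filter⁺ _ (allSubsets-unique _)

  ∈-regionsMet⁺ : ∀ V es h {v} → v ∈ₛ V → v ∈ₛ h → signature es v ∈ regionsMet V es h
  ∈-regionsMet⁺ V es h v∈V v∈h = ∈-filter⁺ _ (∈-allSubsets _) (_ , x∈p∩q⁺ (∈-region-signature V es v∈V , v∈h))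

  ∈-regionsMet⁻ : ∀ V es h {I} → I ∈ regionsMet V es h → ∃ λ v → v ∈ₛ V × v ∈ₛ h × signature es v ≡ I
  ∈-regionsMet⁻ V es h {I} I∈ =
    let (v , v∈R∩h) = proj₂ (∈-filter⁻ (λ I → nonempty? (region V es I ∩ h)) {xs = allSubsets _} I∈)
        (v∈R , v∈h) = x∈p∩q⁻ _ h v∈R∩h
        (v∈V , sig≡I) = ∈-region⁻ V es I v∈R
    in v , v∈V , v∈h , sig≡I

  regionsHit≤numColours : ∀ V es h → regionsHit V es h ≤ numColours h (regionColour es)
  regionsHit≤numColours V es h = ℕP.≤-trans (ℕP.≤-reflexive (sym (length-map encode (regionsMet V es h))))
    (length≤numColours h (regionColour es) (map encode (regionsMet V es h))
      (Unique.map⁺ encode-injective (regionsMet-unique V es h))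
      λ z∈ → let (I , I∈ , z≡) = ∈-map⁻ encode z∈ ; (v , _ , v∈h , sig≡I) = ∈-regionsMet⁻ V es h I∈
             in v , v∈h , trans (cong encode sig≡I) (sym z≡))

  numColours≤regionsHit : ∀ V es h → h ⊆ V → numColours h (regionColour es) ≤ regionsHit V es h
  numColours≤regionsHit V es h h⊆V = ℕP.≤-trans
    (numColours≤length h (regionColour es) (map encode (regionsMet V es h))
      λ v∈h → ∈-map⁺ encode (∈-regionsMet⁺ V es h (h⊆V v∈h) v∈h))
    (ℕP.≤-reflexive (length-map encode (regionsMet V es h)))

  ContainsClass : (V : Subset N) (es : List (Subset N)) → Subset N → Set
  ContainsClass V es h = ∃ λ v → v ∈ₛ V × (∀ {w} → w ∈ₛ V → signature es w ≡ signature es v → w ∈ₛ h)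

  ContainsRegion⇒ContainsClass : ∀ V es h → ContainsRegion V es h → ContainsClass V es h
  ContainsRegion⇒ContainsClass V es h (I , (v , v∈R) , R⊆h) =
    let (v∈V , sig≡I) = ∈-region⁻ V es I v∈R
    in v , v∈V , λ w∈V sw≡sv → R⊆h (subst (λ J → _ ∈ₛ region V es J) (trans sw≡sv sig≡I) (∈-region-signature V es w∈V))

  ContainsClass⇒ContainsRegion : ∀ V es h → ContainsClass V es h → ContainsRegion V es h
  ContainsClass⇒ContainsRegion V es h (v , v∈V , class⊆h) =
    signature es v , (v , ∈-region-signature V es v∈V) ,
    λ w∈R → let (w∈V , sw≡sv) = ∈-region⁻ V es _ w∈R in class⊆h w∈V sw≡sv

  data Extends : List (Subset N) → List (Subset N) → Set where
    extends-refl : ∀ {es} → Extends es es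
    extends-∷    : ∀ {es′ es} g → Extends es′ es → Extends (g ∷ es′) es

  extends-trans : ∀ {as bs cs} → Extends as bs → Extends bs cs → Extends as cs
  extends-trans extends-refl       bs⊒cs = bs⊒cs
  extends-trans (extends-∷ g as⊒bs) bs⊒cs = extends-∷ g (extends-trans as⊒bs bs⊒cs)

  signature-extends : ∀ {es′ es} → Extends es′ es → ∀ v w →
    signature es′ v ≡ signature es′ w → signature es v ≡ signature es w
  signature-extends extends-refl      v w eq = eq
  signature-extends (extends-∷ g ext) v w eq = signature-extends ext v w (VecP.∷-injectiveʳ eq)

  signature-∈ : ∀ {g es} → g ∈ es → ∀ {v w} → signature es v ≡ signature es w → Vec.lookup g v ≡ Vec.lookup g w
  signature-∈ (here refl) eq = VecP.∷-injectiveˡ eq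
  signature-∈ (there g∈)  eq = signature-∈ g∈ (VecP.∷-injectiveʳ eq)

  regionsHit-extends : ∀ V {es′ es} h → h ⊆ V → Extends es′ es → regionsHit V es h ≤ regionsHit V es′ h
  regionsHit-extends V {es′} {es} h h⊆V ext = begin
    regionsHit V es h              ≤⟨ regionsHit≤numColours V es h ⟩
    numColours h (regionColour es)  ≤⟨ Factor.numColours-factor h (regionColour es) (regionColour es′) refines ⟩
    numColours h (regionColour es′) ≤⟨ numColours≤regionsHit V es′ h h⊆V ⟩
    regionsHit V es′ h             ∎
    where
      open ℕP.≤-Reasoning
      refines : ∀ {v w} → v ∈ₛ h → w ∈ₛ h →
        regionColour es′ v ≡ regionColour es′ w → regionColour es v ≡ regionColour es w
      refines {v} {w} _ _ eq = cong encode (signature-extends ext v w (encode-injective eq))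

  ContainsRegion-extends : ∀ V {es′ es} h → Extends es′ es → ContainsRegion V es h → ContainsRegion V es′ h
  ContainsRegion-extends V {es′} {es} h ext contains =
    let (v , v∈V , class⊆h) = ContainsRegion⇒ContainsClass V es h contains
    in ContainsClass⇒ContainsRegion V es′ h (v , v∈V , λ {w} w∈V eq → class⊆h w∈V (signature-extends ext w v eq))

  regionsHit-positive : ∀ (V : Subset N) es {h} → h ⊆ V → ∀ {v} → v ∈ₛ h → 1 ≤ regionsHit V es h
  regionsHit-positive V es {h} h⊆V v∈h = ∈-length (∈-regionsMet⁺ V es h (h⊆V v∈h) v∈h)

  ContainsRegion? : ∀ (V : Subset N) es h → Dec (ContainsRegion V es h)
  ContainsRegion? V es h = anySubset? λ I → nonempty? (region V es I) ×-dec (region V es I ⊆? h)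

  regionsHit-split : ∀ (V : Subset N) {E* Ec} (g h : Subset N) → h ⊆ V → Extends Ec E* → ∀ {v w} → v ∈ₛ h → w ∈ₛ h →
    v ∈ₛ g → w ∉ₛ g → signature E* v ≡ signature E* w → regionsHit V E* h < regionsHit V (g ∷ Ec) h
  regionsHit-split V {E*} {Ec} g h h⊆V ext {v} {w} v∈h w∈h v∈g w∉g same = begin-strict
    regionsHit V E* h                     ≤⟨ regionsHit≤numColours V E* h ⟩
    numColours h (regionColour E*)        <⟨ Factor.numColours-factor-< h (regionColour E*) (regionColour (g ∷ Ec)) refines
                                               v∈h w∈h (cong encode same) separated ⟩
    numColours h (regionColour (g ∷ Ec))  ≤⟨ numColours≤regionsHit V (g ∷ Ec) h h⊆V ⟩
    regionsHit V (g ∷ Ec) h               ∎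
    where
      open ℕP.≤-Reasoning
      refines : ∀ {x y} → x ∈ₛ h → y ∈ₛ h →
        regionColour (g ∷ Ec) x ≡ regionColour (g ∷ Ec) y → regionColour E* x ≡ regionColour E* y
      refines {x} {y} _ _ eq = cong encode (signature-extends (extends-∷ g ext) x y (encode-injective eq))
      separated : regionColour (g ∷ Ec) v ≢ regionColour (g ∷ Ec) w
      separated eq = w∉g (lookup⇒∈ (trans (sym (VecP.∷-injectiveˡ (encode-injective eq))) (∈⇒lookup v∈g)))

  escape : ∀ V es g → ¬ ContainsRegion V es g → ∀ {v} → v ∈ₛ V →
    ∃ λ w → w ∈ₛ V × signature es w ≡ signature es v × w ∉ₛ g
  escape V es g ¬contains {v} v∈V with ∃∈? (λ w → (signature es w ≟ₛ signature es v) ×-dec ¬? (w ∈? g)) V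
  ... | yes (w , w∈V , same , w∉g) = w , w∈V , same , w∉g
  ... | no none =
    ⊥-elim (¬contains (ContainsClass⇒ContainsRegion V es g (v , v∈V , λ {w} w∈V same → inside w∈V same (w ∈? g))))
    where
      inside : ∀ {w} → w ∈ₛ V → signature es w ≡ signature es v → Dec (w ∈ₛ g) → w ∈ₛ g
      inside _   _    (yes w∈g) = w∈g
      inside w∈V same (no w∉g)  = ⊥-elim (none (_ , w∈V , same , w∉g))

CompatibleEdge : ∀ {N} (V : Subset N) (k : ℕ) (es : List (Subset N)) → Subset N → Set
CompatibleEdge V k es h = regionsHit V es h ≤ k × ¬ ContainsRegion V es h

splitDegenerate-∷ʳ : ∀ (H : Hypergraph) k es f → SplitDegenerate H k es → CompatibleEdge (V H) k es f →
  SplitDegenerate H k (es ∷ʳ f)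
splitDegenerate-∷ʳ H k = snoc (CompatibleEdge (V H) k)
  where
    snoc : ∀ {A : Set} (Q : List A → A → Set) es f →
      (∀ (j : Fin (length es)) → Q (take (Fin.toℕ j) es) (List.lookup es j)) → Q es f →
      ∀ (j : Fin (length (es ∷ʳ f))) → Q (take (Fin.toℕ j) (es ∷ʳ f)) (List.lookup (es ∷ʳ f) j)
    snoc Q []       f _      Qf Fin.zero    = Qf
    snoc Q (e ∷ es) f Q-es   Qf Fin.zero    = Q-es Fin.zero
    snoc Q (e ∷ es) f Q-es   Qf (Fin.suc j) = snoc (λ xs → Q (e ∷ xs)) es f (Q-es ∘ Fin.suc) Qf j


-- Sunflowers, bromeliads and links

disjoint⇒sunflower : ∀ (G : Hypergraph) {p} → 2 ≤ p → (e : Fin p → Subset (n G)) → (∀ i → e i ∈ E G) →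
  (∀ i → Nonempty (e i)) → (∀ {i j} → i ≢ j → ∀ {v} → v ∈ₛ e i → v ∉ₛ e j) → IsSunflower G p e × kernel p e ≡ ⊥
disjoint⇒sunflower G {p} p≥2 e e∈E nonempty disjoint =
  (e∈E , distinct , λ i j i≢j v v∈eᵢ v∈eⱼ → ⊥-elim (disjoint i≢j v∈eᵢ v∈eⱼ)) ,
  Empty-unique λ (v , v∈ker) → disjoint 0≢1 (∈-kernel⁻ v∈ker first) (∈-kernel⁻ v∈ker second)
  where
    distinct : ∀ i j → i ≢ j → e i ≢ e j
    distinct i j i≢j eᵢ≡eⱼ = let (v , v∈eᵢ) = nonempty i in disjoint i≢j v∈eᵢ (subst (v ∈ₛ_) eᵢ≡eⱼ v∈eᵢ)
    first second : Fin p
    first  = Fin.fromℕ< (ℕP.<-≤-trans (s≤s z≤n) p≥2)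
    second = Fin.fromℕ< p≥2
    0≢1 : first ≢ second
    0≢1 eq = ℕP.0≢1+n (trans (sym (FinP.toℕ-fromℕ< _)) (trans (cong Fin.toℕ eq) (FinP.toℕ-fromℕ< p≥2)))


nested⇒Bromeliad : ∀ (H : Hypergraph) {b′} (f : Fin (suc b′) → Subset (n H)) → (∀ i → f i ∈ E H) →
  (∀ {i j} → i Fin.< j → f j ∩ f Fin.zero ⊂ f i ∩ f Fin.zero) → Nonempty (f (Fin.fromℕ b′) ∩ f Fin.zero) →
  (∀ {i j} → i ≢ j → ∀ {v} → v ∈ₛ f i → v ∈ₛ f j → v ∈ₛ f Fin.zero) →
  Bromeliad' H b′
nested⇒Bromeliad H {b′} f f∈E shrinking last-nonempty meet-in-f₀ = record
  { f = f ; C = C ; P = P ; f-edge = f∈E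
  ; part-∪ = λ i → p∩q∪p─q≡p (f i) f₀
  ; part-∩ = λ i → disjoint⇒∩≡⊥ λ v∈C v∈P → proj₂ (x∈p─q⁻ (f i) f₀ v∈P) (proj₂ (x∈p∩q⁻ (f i) f₀ v∈C))
  ; f₁≡C₁ = sym (∩-idem f₀)
  ; C-chain = λ i j i<j → shrinking i<j
  ; C-last = last-nonempty
  ; P-disj = λ i j i≢j → disjoint⇒∩≡⊥ λ v∈Pᵢ v∈Pⱼ →
      let (v∈fᵢ , v∉f₀) = x∈p─q⁻ (f i) f₀ v∈Pᵢ in v∉f₀ (meet-in-f₀ i≢j v∈fᵢ (proj₁ (x∈p─q⁻ (f j) f₀ v∈Pⱼ)))
  ; P-C₁-disj = λ i → disjoint⇒∩≡⊥ λ v∈P v∈C → proj₂ (x∈p─q⁻ (f i) f₀ v∈P) (proj₁ (x∈p∩q⁻ f₀ f₀ v∈C))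
  }
  where
    f₀ = f Fin.zero
    C P : Fin (suc b′) → Subset (n H)
    C i = f i ∩ f₀
    P i = f i ─ f₀

module _ (G : Hypergraph) where

  ∈-link⁺ : ∀ S {h} → h ∈ E G → S ⊆ h → h ─ S ∈ E (link G S)
  ∈-link⁺ S h∈ S⊆h = ∈-map⁺ (_─ S) (∈-filter⁺ (S ⊆?_) h∈ S⊆h)

  ∈-link⁻ : ∀ S {x} → x ∈ E (link G S) → ∃ λ h → h ∈ E G × S ⊆ h × x ≡ h ─ S
  ∈-link⁻ S x∈ =
    let (h , h∈ , x≡) = ∈-map⁻ (_─ S) x∈
        (h∈E , S⊆h) = ∈-filter⁻ (S ⊆?_) {xs = E G} h∈
    in h , h∈E , S⊆h , x≡

  link-Wf : Wf G → ∀ S → Wf (link G S)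
  link-Wf wf S = All.tabulate λ x∈ {v} v∈x →
    let (h , h∈ , _ , x≡) = ∈-link⁻ S x∈
        (v∈h , v∉S) = x∈p─q⁻ h S (subst (v ∈ₛ_) x≡ v∈x)
    in x∈p∧x∉q⇒x∈p─q (All.lookup wf h∈ v∈h) v∉S

  -- A sunflower of the link lifts to the sunflower of the edges it came from, whose kernel gains at most S.
  link-NoSunflower : ∀ {p t} → NoSunflower G p t → ∀ S → ∣ S ∣ ≤ t → NoSunflower (link G S) p (t ∸ ∣ S ∣)
  link-NoSunflower {p} {t} noSunflower S ∣S∣≤t (e′ , (e′∈ , e′-distinct , e′-sunflower) , ∣ker∣<) =
    noSunflower (e , (e∈ , e-distinct , e-sunflower) , ∣ker∣<t)
    where
      lift : ∀ i → ∃ λ h → h ∈ E G × S ⊆ h × e′ i ≡ h ─ S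
      lift i = ∈-link⁻ S (e′∈ i)
      e : Fin p → Subset (n G)
      e i = proj₁ (lift i)
      e∈ : ∀ i → e i ∈ E G
      e∈ i = proj₁ (proj₂ (lift i))
      S⊆e : ∀ i → S ⊆ e i
      S⊆e i = proj₁ (proj₂ (proj₂ (lift i)))
      e′≡ : ∀ i → e′ i ≡ e i ─ S
      e′≡ i = proj₂ (proj₂ (proj₂ (lift i)))
      e-distinct : ∀ i j → i ≢ j → e i ≢ e j
      e-distinct i j i≢j eᵢ≡eⱼ = e′-distinct i j i≢j (trans (e′≡ i) (trans (cong (_─ S) eᵢ≡eⱼ) (sym (e′≡ j))))
      into-e′ : ∀ {v} i → v ∈ₛ e i → v ∉ₛ S → v ∈ₛ e′ i
      into-e′ i v∈ v∉S = subst (_ ∈ₛ_) (sym (e′≡ i)) (x∈p∧x∉q⇒x∈p─q v∈ v∉S)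
      out-of-e′ : ∀ {v} i → v ∈ₛ e′ i → v ∈ₛ e i
      out-of-e′ i v∈ = proj₁ (x∈p─q⁻ (e i) S (subst (_ ∈ₛ_) (e′≡ i) v∈))
      e-sunflower : ∀ i j → i ≢ j → ∀ v → v ∈ₛ e i → v ∈ₛ e j → ∀ k → v ∈ₛ e k
      e-sunflower i j i≢j v v∈eᵢ v∈eⱼ k with v ∈? S
      ... | yes v∈S = S⊆e k v∈S
      ... | no v∉S  = out-of-e′ k (e′-sunflower i j i≢j v (into-e′ i v∈eᵢ v∉S) (into-e′ j v∈eⱼ v∉S) k)
      ker⊆ : kernel p e ⊆ kernel p e′ ∪ S
      ker⊆ {v} v∈ker with v ∈? S
      ... | yes v∈S = x∈p∪q⁺ (inj₂ v∈S)
      ... | no v∉S  = x∈p∪q⁺ (inj₁ (∈-kernel⁺ λ i → into-e′ i (∈-kernel⁻ v∈ker i) v∉S))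
      ∣ker∣<t : ∣ kernel p e ∣ < t
      ∣ker∣<t = begin-strict
        ∣ kernel p e ∣            ≤⟨ p⊆q⇒∣p∣≤∣q∣ ker⊆ ⟩
        ∣ kernel p e′ ∪ S ∣       ≤⟨ ∣p∪q∣≤∣p∣+∣q∣ (kernel p e′) S ⟩
        ∣ kernel p e′ ∣ + ∣ S ∣   <⟨ ℕP.+-monoˡ-< ∣ S ∣ ∣ker∣< ⟩
        t ∸ ∣ S ∣ + ∣ S ∣         ≡⟨ ℕP.m∸n+n≡m ∣S∣≤t ⟩
        t                         ∎
        where open ℕP.≤-Reasoning

∈-link-link⁻ : ∀ G S S′ {x} → x ∈ E (link (link G S) S′) → x ∈ E (link G (S ∪ S′))
∈-link-link⁻ G S S′ x∈ =
  let (y , y∈ , S′⊆y , x≡) = ∈-link⁻ (link G S) S′ x∈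
      (h , h∈ , S⊆h , y≡) = ∈-link⁻ G S y∈
      S′⊆h : S′ ⊆ h
      S′⊆h v∈S′ = p─q⊆p h S (subst (_ ∈ₛ_) y≡ (S′⊆y v∈S′))
  in subst (_∈ E (link G (S ∪ S′))) (sym (trans x≡ (trans (cong (_─ S′) y≡) (p─q─r≡p─q∪r h S S′))))
       (∈-link⁺ G (S ∪ S′) h∈ λ v∈ → [ S⊆h , S′⊆h ]′ (x∈p∪q⁻ S S′ v∈))

ChiAtMost-link-link : ∀ G S S′ {c K} → ChiAtMost (link G (S ∪ S′)) c K → ChiAtMost (link (link G S) S′) c K
ChiAtMost-link-link G S S′ (f , strong , bound) =
  f , (λ x x∈ → strong x (∈-link-link⁻ G S S′ x∈)) ,
  subst (λ X → numColours X f ≤ _) (sym (p─q─r≡p─q∪r (V G) S S′)) bound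

LinksColourable : (G : Hypergraph) (s ℓ χ : ℕ) → Set
LinksColourable G s ℓ χ = ∀ (S : Subset (n G)) → S ⊆ V G → ∣ S ∣ ≡ s → ChiAtMost (link G S) ℓ χ

ColouringBound : (p s ℓ χ K : ℕ) → Set
ColouringBound p s ℓ χ K =
  ∀ (G : Hypergraph) → Wf G → NoSunflower G p s → LinksColourable G s ℓ χ → ChiAtMost G (s + ℓ) K

ColouringBound-mono : ∀ {p s ℓ χ K K′} → K ≤ K′ → ColouringBound p s ℓ χ K → ColouringBound p s ℓ χ K′
ColouringBound-mono K≤K′ bound G wf noSunflower links =
  let (f , strong , ≤K) = bound G wf noSunflower links in f , strong , ℕP.≤-trans ≤K K≤K′


-- Partial colourings

module Colouring (H : Hypergraph) (c : ℕ) where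

  Colourable : (Subset (n H) → Set) → ℕ → Set
  Colourable P K = Σ (Fin (n H) → ℕ) λ f →
    (∀ e → e ∈ E H → P e → c ⊓ ∣ e ∣ ≤ numColours e f) × numColours (V H) f ≤ K

  colourable-weaken : ∀ {P Q K K′} → (∀ e → e ∈ E H → Q e → P e) → K ≤ K′ → Colourable P K → Colourable Q K′
  colourable-weaken Q⇒P K≤K′ (f , strong , bound) = f , (λ e e∈ → strong e e∈ ∘ Q⇒P e e∈) , ℕP.≤-trans bound K≤K′

  colourable-∅ : ∀ {P : Subset (n H) → Set} {K} → 1 ≤ K → (∀ e → e ∈ E H → ¬ P e) → Colourable P K
  colourable-∅ K≥1 none = (λ _ → 0) , (λ e e∈ Pe → ⊥-elim (none e e∈ Pe)) , ℕP.≤-trans (numColours-const≤1 (V H) 0) K≥1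

  colourable-⊎ : ∀ {P Q K₁ K₂} → Colourable P K₁ → Colourable Q K₂ → Colourable (λ e → P e ⊎ Q e) (K₁ * K₂)
  colourable-⊎ (f , strong-f , bound-f) (g , strong-g , bound-g) =
    (λ v → pair (f v) (g v)) ,
    (λ { e e∈ (inj₁ Pe) → ℕP.≤-trans (strong-f e e∈ Pe) (numColours≤numColours-pairˡ e f g)
       ; e e∈ (inj₂ Qe) → ℕP.≤-trans (strong-g e e∈ Qe) (numColours≤numColours-pairʳ e f g) }) ,
    ℕP.≤-trans (numColours-pair≤* (V H) f g) (ℕP.*-mono-≤ bound-f bound-g)

  colourable-⋃ : ∀ {I : Set} (is : List I) {P : I → Subset (n H) → Set} {K : I → ℕ} →
    (∀ {i} → i ∈ is → Colourable (P i) (K i)) → Colourable (λ e → ∃ λ i → i ∈ is × P i e) (product (map K is))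
  colourable-⋃     []       _   = colourable-∅ ℕP.≤-refl λ { _ _ (_ , () , _) }
  colourable-⋃ {I} (i ∷ is) col =
    colourable-weaken split ℕP.≤-refl (colourable-⊎ (col (here refl)) (colourable-⋃ is (col ∘ there)))
    where
      split : ∀ {P : I → Subset (n H) → Set} e → e ∈ E H →
        (∃ λ j → j ∈ i ∷ is × P j e) → P i e ⊎ (∃ λ j → j ∈ is × P j e)
      split e _ (_ , here refl , Pe) = inj₁ Pe
      split e _ (j , there j∈ , Pe)  = inj₂ (j , j∈ , Pe)

incompatibleBound : ℕ → ℕ → ℕ
incompatibleBound c L = 2 ^ L * c ^ 2 ^ L

module IncompatibleEdges (H : Hypergraph) (t ℓ p χ K : ℕ) (t≥1 : 1 ≤ t) (wf : Wf H)
  (noSunflower : NoSunflower H p t) (links : LinksColourable H t ℓ χ)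
  (smaller : ∀ s → s < t → ColouringBound p s ℓ χ K) (χ≤K : χ ≤ K) where

  open Colouring H (t + ℓ)

  linkColouring : ∀ S → S ⊆ V H → 1 ≤ ∣ S ∣ → ∣ S ∣ ≤ t →
    Σ (Fin (n H) → ℕ) λ g → Strong (link H S) (t ∸ ∣ S ∣ + ℓ) g × numColours (V H ─ S) g ≤ K
  linkColouring S S⊆V ∣S∣≥1 ∣S∣≤t with ℕP.m≤n⇒m<n∨m≡n ∣S∣≤t
  ... | inj₂ ∣S∣≡t =
    let (g , strong , ≤χ) = links S S⊆V ∣S∣≡t
    in g , subst (λ s → Strong (link H S) (s + ℓ) g) (sym (trans (cong (t ∸_) ∣S∣≡t) (ℕP.n∸n≡0 t))) strong ,
       ℕP.≤-trans ≤χ χ≤K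
  ... | inj₁ ∣S∣<t = smaller (t ∸ ∣ S ∣) (ℕP.∸-monoʳ-< ∣S∣≥1 ∣S∣≤t) (link H S) (link-Wf H wf S)
    (link-NoSunflower H noSunflower S ∣S∣≤t)
    λ S′ S′⊆ ∣S′∣≡ → ChiAtMost-link-link H S S′ (links (S ∪ S′) (S∪S′⊆V S′ S′⊆) (∣S∪S′∣≡t S′ S′⊆ ∣S′∣≡))
    where
      S∪S′⊆V : ∀ S′ → S′ ⊆ V H ─ S → S ∪ S′ ⊆ V H
      S∪S′⊆V S′ S′⊆ v∈ = [ S⊆V , p─q⊆p (V H) S ∘ S′⊆ ]′ (x∈p∪q⁻ S S′ v∈)
      ∣S∪S′∣≡t : ∀ S′ → S′ ⊆ V H ─ S → ∣ S′ ∣ ≡ t ∸ ∣ S ∣ → ∣ S ∪ S′ ∣ ≡ t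
      ∣S∪S′∣≡t S′ S′⊆ ∣S′∣≡ = begin
        ∣ S ∪ S′ ∣      ≡⟨ ∣p∪q∣≡∣p∣+∣q∣ S S′ (λ v∈S v∈S′ → proj₂ (x∈p─q⁻ (V H) S (S′⊆ v∈S′)) v∈S) ⟩
        ∣ S ∣ + ∣ S′ ∣  ≡⟨ cong (∣ S ∣ +_) ∣S′∣≡ ⟩
        ∣ S ∣ + (t ∸ ∣ S ∣) ≡⟨ ℕP.m+[n∸m]≡n ∣S∣≤t ⟩
        t               ∎
        where open ≡-Reasoning

  containsSetColouring : ∀ A → A ⊆ V H → Colourable (λ h → Nonempty A × A ⊆ h) (t + K)
  containsSetColouring A A⊆V with nonempty? A
  ... | no empty = colourable-∅ (ℕP.≤-trans t≥1 (ℕP.m≤m+n t K)) λ _ _ (nonempty , _) → empty nonempty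
  ... | yes (a , a∈A) = separate S g , strong , bound
    where
      S = takeSubset t A
      S⊆A = takeSubset-⊆ t A
      ∣S∣≤t : ∣ S ∣ ≤ t
      ∣S∣≤t = subst (_≤ t) (sym (∣takeSubset∣ t A)) (ℕP.m⊓n≤m t ∣ A ∣)
      ∣S∣≥1 : 1 ≤ ∣ S ∣
      ∣S∣≥1 = subst (1 ≤_) (sym (∣takeSubset∣ t A)) (ℕP.⊓-glb t≥1 (ℕP.≤-trans (s≤s z≤n) (x∈p⇒∣p-x∣<∣p∣ a∈A)))
      link-colouring = linkColouring S (A⊆V ∘ S⊆A) ∣S∣≥1 ∣S∣≤t
      g = proj₁ link-colouring
      g-strong = proj₁ (proj₂ link-colouring)
      g-bound = proj₂ (proj₂ link-colouring)
      bound : numColours (V H) (separate S g) ≤ t + K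
      bound = ℕP.≤-trans (numColours-separate≤ S g (V H)) (ℕP.+-mono-≤ ∣S∣≤t g-bound)
      strong : ∀ h → h ∈ E H → Nonempty A × A ⊆ h → (t + ℓ) ⊓ ∣ h ∣ ≤ numColours h (separate S g)
      strong h h∈ (_ , A⊆h) = begin
        (t + ℓ) ⊓ ∣ h ∣                              ≡⟨ cong ((t + ℓ) ⊓_) (sym (∣p─q∣+∣q∣≡∣p∣ h S S⊆h)) ⟩
        (t + ℓ) ⊓ (∣ h ─ S ∣ + ∣ S ∣)                ≡⟨ +-⊓-∸ ℓ ∣ h ─ S ∣ ∣S∣≤t ⟩
        ∣ S ∣ + (t ∸ ∣ S ∣ + ℓ) ⊓ ∣ h ─ S ∣          ≤⟨ ℕP.+-monoʳ-≤ ∣ S ∣ (g-strong (h ─ S) (∈-link⁺ H S h∈ S⊆h)) ⟩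
        ∣ S ∣ + numColours (h ─ S) g                ≤⟨ ≤numColours-separate S g h S⊆h ⟩
        numColours h (separate S g)                 ∎
        where
          open ℕP.≤-Reasoning
          S⊆h : S ⊆ h
          S⊆h = A⊆h ∘ S⊆A

  Incompatible : List (Subset (n H)) → Subset (n H) → Set
  Incompatible es h = (t + ℓ ≤ regionsHit (V H) es h) ⊎ ContainsRegion (V H) es h

  manyRegionsColouring : ∀ es → Colourable (λ h → t + ℓ ≤ regionsHit (V H) es h) (2 ^ length es)
  manyRegionsColouring es = regionColour es ,
    (λ h _ many → ℕP.≤-trans (ℕP.m⊓n≤m _ _) (ℕP.≤-trans many (regionsHit≤numColours (V H) es h))) ,
    ℕP.≤-trans (numColours≤length (V H) (regionColour es) (map encode (allSubsets (length es)))
                  (λ {v} _ → ∈-map⁺ encode (∈-allSubsets (signature es v))))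
               (ℕP.≤-reflexive (trans (length-map encode (allSubsets (length es))) (length-allSubsets (length es))))

  incompatibleColouring : ∀ es → Colourable (Incompatible es) (incompatibleBound (t + K) (length es))
  incompatibleColouring es = colourable-weaken classify (ℕP.≤-reflexive bound≡)
    (colourable-⊎ (manyRegionsColouring es) (colourable-⋃ (allSubsets (length es)) containsRegion))
    where
      R = region (V H) es
      containsRegion : ∀ {I} → I ∈ allSubsets (length es) → Colourable (λ h → Nonempty (R I) × R I ⊆ h) (t + K)
      containsRegion {I} _ = containsSetColouring (R I) (proj₁ ∘ ∈-region⁻ (V H) es I)
      classify : ∀ h → h ∈ E H → Incompatible es h →
        t + ℓ ≤ regionsHit (V H) es h ⊎ ∃ λ I → I ∈ allSubsets (length es) × Nonempty (R I) × R I ⊆ h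
      classify h _ (inj₁ many)           = inj₁ many
      classify h _ (inj₂ (I , ne , R⊆h)) = inj₂ (I , ∈-allSubsets I , ne , λ {v} → R⊆h {v})
      bound≡ : 2 ^ length es * product (map (λ _ → t + K) (allSubsets (length es)))
             ≡ incompatibleBound (t + K) (length es)
      bound≡ = cong (2 ^ length es *_) (trans (product-map-const (t + K) (allSubsets (length es)))
                                              (cong ((t + K) ^_) (length-allSubsets (length es))))

module Bounds (c B : ℕ) where

  chainLength : ℕ → ℕ
  chainLength m = suc (2 ^ m * B)

  mutual
    meetsManyBound : ℕ → ℕ → ℕ
    meetsManyBound zero    L = incompatibleBound c L
    meetsManyBound (suc d) L =
      incompatibleBound c L *
      product (map (λ β → chainBound d L (length β) (chainLength (length β))) (sublists (allSubsets L)))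

    chainBound : ℕ → ℕ → ℕ → ℕ → ℕ
    chainBound d L m zero    = 1
    chainBound d L m (suc f) = incompatibleBound c L * extensionBound d L m f

    extensionBound : ℕ → ℕ → ℕ → ℕ → ℕ
    extensionBound d L m f = incompatibleBound c (suc L) * (meetsManyBound d (suc L) * chainBound d (suc L) m f ^ 2 ^ m)

  module _ (c≥1 : 1 ≤ c) where

    incompatibleBound-positive : ∀ L → 1 ≤ incompatibleBound c L
    incompatibleBound-positive L = ℕP.*-mono-≤ (1≤^ L (s≤s z≤n)) (1≤^ (2 ^ L) c≥1)

    mutual
      meetsManyBound-positive : ∀ d L → 1 ≤ meetsManyBound d L
      meetsManyBound-positive zero    L = incompatibleBound-positive L
      meetsManyBound-positive (suc d) L = ℕP.*-mono-≤ (incompatibleBound-positive L) (1≤product (AllP.map⁺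
        {xs = sublists (allSubsets L)} (All.tabulate λ {β} _ →
          chainBound-positive d L (length β) (chainLength (length β)))))

      chainBound-positive : ∀ d L m f → 1 ≤ chainBound d L m f
      chainBound-positive d L m zero    = ℕP.≤-refl
      chainBound-positive d L m (suc f) = ℕP.*-mono-≤ (incompatibleBound-positive L) (extensionBound-positive d L m f)

      extensionBound-positive : ∀ d L m f → 1 ≤ extensionBound d L m f
      extensionBound-positive d L m f = ℕP.*-mono-≤ (incompatibleBound-positive (suc L))
        (ℕP.*-mono-≤ (meetsManyBound-positive d (suc L)) (1≤^ (2 ^ m) (chainBound-positive d (suc L) m f)))


-- The chain argument

module ChainArgument (H : Hypergraph) (t ℓ p χ K : ℕ) (t≥1 : 1 ≤ t) (wf : Wf H)
  (noSunflower : NoSunflower H p t) (links : LinksColourable H t ℓ χ)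
  (smaller : ∀ s → s < t → ColouringBound p s ℓ χ K) (χ≤K : χ ≤ K)
  (p≥2 : 2 ≤ p) (b′ : ℕ) (es₀ : List (Subset (n H))) (es₀-sd : SplitDegenerate H (t + ℓ ∸ 1) es₀) where

  open IncompatibleEdges H t ℓ p χ K t≥1 wf noSunflower links smaller χ≤K
  open Colouring H (t + ℓ)

  k : ℕ
  k = t + ℓ ∸ 1

  open Bounds (t + K) (suc b′ + p)

  1+k≡t+ℓ : suc k ≡ t + ℓ
  1+k≡t+ℓ = ℕP.m+[n∸m]≡n (ℕP.≤-trans t≥1 (ℕP.m≤m+n t ℓ))

  edge⊆V : ∀ {h} → h ∈ E H → h ⊆ V H
  edge⊆V = All.lookup wf

  CompatibleWith : List (Subset (n H)) → Subset (n H) → Set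
  CompatibleWith = CompatibleEdge (V H) k

  Compatible? : ∀ es h → Dec (CompatibleWith es h)
  Compatible? es h = (regionsHit (V H) es h ≤? k) ×-dec ¬? (ContainsRegion? (V H) es h)

  classify : ∀ es h → CompatibleWith es h ⊎ Incompatible es h
  classify es h with regionsHit (V H) es h ≤? k | ContainsRegion? (V H) es h
  ... | no >k  | _              = inj₂ (inj₁ (subst (_≤ regionsHit (V H) es h) 1+k≡t+ℓ (ℕP.≰⇒> >k)))
  ... | yes _  | yes contains   = inj₂ (inj₂ contains)
  ... | yes ≤k | no ¬contains   = inj₁ (≤k , ¬contains)

  CompatibleEdge-extends : ∀ {es′ es h} → h ⊆ V H → Extends es′ es →
    CompatibleWith es′ h → CompatibleWith es h
  CompatibleEdge-extends h⊆V ext (≤k , ¬contains) =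
    ℕP.≤-trans (regionsHit-extends (V H) _ h⊆V ext) ≤k , ¬contains ∘ ContainsRegion-extends (V H) _ ext

  Result : Set
  Result = Σ (Bromeliad H (suc b′)) (Compatible H k es₀ (suc b′))

  FindOrColour : (Subset (n H) → Set) → ℕ → Set
  FindOrColour P K = Result ⊎ Colourable P K

  findOrColour-weaken : ∀ {P Q K K′} → (∀ e → e ∈ E H → Q e → P e) → K ≤ K′ → FindOrColour P K → FindOrColour Q K′
  findOrColour-weaken Q⇒P K≤K′ = Sum.map₂ (colourable-weaken Q⇒P K≤K′)

  findOrColour-⊎ : ∀ {P Q K₁ K₂} → FindOrColour P K₁ → FindOrColour Q K₂ → FindOrColour (λ e → P e ⊎ Q e) (K₁ * K₂)
  findOrColour-⊎ (inj₁ r)  _         = inj₁ r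
  findOrColour-⊎ (inj₂ _)  (inj₁ r)  = inj₁ r
  findOrColour-⊎ (inj₂ cP) (inj₂ cQ) = inj₂ (colourable-⊎ cP cQ)

  findOrColour-⋃ : ∀ {I : Set} (is : List I) {P : I → Subset (n H) → Set} {K : I → ℕ} →
    (∀ {i} → i ∈ is → FindOrColour (P i) (K i)) → FindOrColour (λ e → ∃ λ i → i ∈ is × P i e) (product (map K is))
  findOrColour-⋃ is found-or-coloured = Sum.map₂ (colourable-⋃ is) (inj₁-or-all-inj₂ is found-or-coloured)

  -- A chain entry: an edge g and the regions γ ⊆ β in which the later edges of the chain meet g.
  record Choice (L : ℕ) : Set where
    constructor choice
    field
      edge    : Subset (n H)
      regions : List (Subset L)
  open Choice

  MeetsMany : ℕ → List (Subset (n H)) → Subset (n H) → Set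
  MeetsMany d Ec h = k < d + regionsHit (V H) Ec h

  module Chain (E* : List (Subset (n H))) (β : List (Subset (length E*))) where

    sig : Fin (n H) → Subset (length E*)
    sig = signature E*

    Meets : Subset (n H) → Set
    Meets h = regionsMet (V H) E* h ≡ β

    Respects : Subset (n H) → Choice (length E*) → Set
    Respects h r = ∀ {v} → v ∈ₛ h → (v ∈ₛ edge r → sig v ∈ regions r) × (sig v ∈ regions r → v ∈ₛ edge r)

    Strict : Subset (n H) → Choice (length E*) → Set
    Strict h r = ∀ {σ} → σ ∈ regions r → ∃ λ w → w ∈ₛ edge r × sig w ≡ σ × w ∉ₛ h

    record Valid (r : Choice (length E*)) : Set where
      field
        edge∈E     : edge r ∈ E H
        meets      : Meets (edge r)
        compatible : CompatibleWith es₀ (edge r)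
        regions∈   : regions r ∈ sublists β
    open Valid

    Precedes : Choice (length E*) → Choice (length E*) → Set
    Precedes r′ r = Respects (edge r′) r × Strict (edge r′) r

    InClass : List (Choice (length E*)) → Subset (n H) → Set
    InClass cs h = Meets h × All (Respects h) cs

    meets-vertex : ∀ {h} → Meets h → ∀ {σ} → σ ∈ β → ∃ λ v → v ∈ₛ h × sig v ≡ σ
    meets-vertex {h} meets σ∈β =
      let (v , _ , v∈h , sig≡σ) = ∈-regionsMet⁻ (V H) E* h (subst (_ ∈_) (sym meets) σ∈β) in v , v∈h , sig≡σ

    meets-signature : ∀ {h} → h ⊆ V H → Meets h → ∀ {v} → v ∈ₛ h → sig v ∈ β
    meets-signature {h} h⊆V meets v∈h = subst (_ ∈_) meets (∈-regionsMet⁺ (V H) E* h (h⊆V v∈h) v∈h)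

    -- The trace f i ∩ f₀ is the part of f i in the regions σ₀ ∷ γ₀, and these traces shrink strictly.
    chain⇒Result : ∀ {σ₀ γ₀} ys → All Valid ys → AllPairs Precedes ys → All (λ r → regions r ≡ σ₀ ∷ γ₀) ys →
      suc b′ ≤ length ys → Result
    chain⇒Result {σ₀} {γ₀} ys valid ordered same-regions long =
      nested⇒Bromeliad H f (edge∈E ∘ valid-r) shrinking last-nonempty meet-in-f₀ ,
      λ i → splitDegenerate-∷ʳ H k es₀ (f i) es₀-sd (compatible (valid-r i))
      where
        sample = AllPairs-sample (suc b′) long ordered
        r : Fin (suc b′) → Choice (length E*)
        r = proj₁ sample
        r∈ys : ∀ i → r i ∈ ys
        r∈ys = proj₁ (proj₂ sample)
        precedes : ∀ {i j} → i Fin.< j → Precedes (r j) (r i)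
        precedes = proj₂ (proj₂ sample)
        f : Fin (suc b′) → Subset (n H)
        f i = edge (r i)
        f₀ = f Fin.zero
        γ = σ₀ ∷ γ₀
        valid-r : ∀ i → Valid (r i)
        valid-r i = All.lookup valid (r∈ys i)
        regions≡ : ∀ i → regions (r i) ≡ γ
        regions≡ i = All.lookup same-regions (r∈ys i)
        σ₀∈ : ∀ {v} → sig v ≡ σ₀ → sig v ∈ γ
        σ₀∈ sig≡σ₀ = subst (_∈ γ) (sym sig≡σ₀) (here refl)
        respects : ∀ {i j v} → i Fin.< j → v ∈ₛ f j → (v ∈ₛ f i → sig v ∈ γ) × (sig v ∈ γ → v ∈ₛ f i)
        respects {i} {j} {v} i<j v∈fⱼ =
          let (into , out-of) = proj₁ (precedes i<j) v∈fⱼ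
          in subst (sig v ∈_) (regions≡ i) ∘ into , out-of ∘ subst (sig v ∈_) (sym (regions≡ i))
        into-f₀ : ∀ j {v} → v ∈ₛ f j → sig v ∈ γ → v ∈ₛ f₀
        into-f₀ Fin.zero    v∈f₀ _     = v∈f₀
        into-f₀ (Fin.suc j) v∈fⱼ sig∈γ = proj₂ (respects {Fin.zero} {Fin.suc j} (s≤s z≤n) v∈fⱼ) sig∈γ
        shrinking : ∀ {i j} → i Fin.< j → f j ∩ f₀ ⊂ f i ∩ f₀
        shrinking {i} {j} i<j =
          trace⊆ , w , x∈p∩q⁺ (w∈fᵢ , into-f₀ i w∈fᵢ (σ₀∈ sig-w)) , λ w∈ → w∉fⱼ (proj₁ (x∈p∩q⁻ (f j) f₀ w∈))
          where
            trace⊆ : f j ∩ f₀ ⊆ f i ∩ f₀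
            trace⊆ v∈ = let (v∈fⱼ , v∈f₀) = x∈p∩q⁻ (f j) f₀ v∈ in
              x∈p∩q⁺ (proj₂ (respects i<j v∈fⱼ) (proj₁ (respects {Fin.zero} (ℕP.≤-<-trans z≤n i<j) v∈fⱼ) v∈f₀) , v∈f₀)
            witness = proj₂ (precedes i<j) (subst (σ₀ ∈_) (sym (regions≡ i)) (here refl))
            w = proj₁ witness
            w∈fᵢ = proj₁ (proj₂ witness)
            sig-w = proj₁ (proj₂ (proj₂ witness))
            w∉fⱼ = proj₂ (proj₂ (proj₂ witness))
        last-nonempty : Nonempty (f (Fin.fromℕ b′) ∩ f₀)
        last-nonempty =
          let σ₀∈β = ∈-sublists⇒⊆ β (subst (_∈ sublists β) (regions≡ Fin.zero) (regions∈ (valid-r Fin.zero)))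
                                   (here refl)
              (v , v∈f , sig-v) = meets-vertex (meets (valid-r (Fin.fromℕ b′))) σ₀∈β
          in v , x∈p∩q⁺ (v∈f , into-f₀ (Fin.fromℕ b′) v∈f (σ₀∈ sig-v))
        meet-in-f₀ : ∀ {i j} → i ≢ j → ∀ {v} → v ∈ₛ f i → v ∈ₛ f j → v ∈ₛ f₀
        meet-in-f₀ {i} {j} i≢j v∈fᵢ v∈fⱼ with FinP.<-cmp i j
        ... | tri< i<j _ _ = into-f₀ j v∈fⱼ (proj₁ (respects i<j v∈fⱼ) v∈fᵢ)
        ... | tri≈ _ i≡j _ = ⊥-elim (i≢j i≡j)
        ... | tri> _ _ j<i = into-f₀ i v∈fᵢ (proj₁ (respects j<i v∈fᵢ) v∈fⱼ)

    -- With no regions in common the chain edges are pairwise disjoint, a sunflower with empty kernel.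
    disjoint-chain-short : 1 ≤ length β → ∀ ys → All Valid ys → AllPairs Precedes ys → All (λ r → regions r ≡ []) ys →
      p ≰ length ys
    disjoint-chain-short β≢[] ys valid ordered no-regions long =
      noSunflower (e , proj₁ sunflower ,
                   subst (λ X → ∣ X ∣ < t) (sym (proj₂ sunflower)) (subst (_< t) (sym (∣⊥∣≡0 (n H))) t≥1))
      where
        sample = AllPairs-sample p long ordered
        r∈ys = proj₁ (proj₂ sample)
        e : Fin p → Subset (n H)
        e i = edge (proj₁ sample i)
        valid-e : ∀ i → Valid (proj₁ sample i)
        valid-e i = All.lookup valid (r∈ys i)
        nonempty : ∀ i → Nonempty (e i)
        nonempty i = let (v , v∈e , _) = meets-vertex (meets (valid-e i)) (proj₂ (nonempty-list β≢[])) in v , v∈e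
        ordered-disjoint : ∀ {i j} → i Fin.< j → ∀ {v} → v ∈ₛ e i → v ∉ₛ e j
        ordered-disjoint {i} i<j v∈eᵢ v∈eⱼ with () ← subst (_ ∈_) (All.lookup no-regions (r∈ys i))
          (proj₁ (proj₁ (proj₂ (proj₂ sample) i<j) v∈eⱼ) v∈eᵢ)
        disjoint : ∀ {i j} → i ≢ j → ∀ {v} → v ∈ₛ e i → v ∉ₛ e j
        disjoint {i} {j} i≢j v∈eᵢ v∈eⱼ with FinP.<-cmp i j
        ... | tri< i<j _ _ = ordered-disjoint i<j v∈eᵢ v∈eⱼ
        ... | tri≈ _ i≡j _ = i≢j i≡j
        ... | tri> _ _ j<i = ordered-disjoint j<i v∈eⱼ v∈eᵢ
        sunflower = disjoint⇒sunflower H p≥2 e (edge∈E ∘ valid-e) nonempty disjoint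

    long-chain⇒Result : 1 ≤ length β → ∀ cs → All Valid cs → AllPairs Precedes cs →
      chainLength (length β) ≤ length cs → Result
    long-chain⇒Result β≢[] cs valid ordered long
      with pigeonhole regions _≟ₗ_ (sublists β) (suc b′ + p) cs
             (regions∈ ∘ All.lookup valid)
             (subst (λ m → m * (suc b′ + p) < length cs) (sym (length-sublists β)) long)
    ... | γ , many = from-regions γ refl
      where
        has-γ? = λ r → regions r ≟ₗ γ
        ys = filter has-γ? cs
        valid′ = AllP.filter⁺ has-γ? valid
        ordered′ = AllPairsP.filter⁺ has-γ? ordered
        same-regions = AllP.all-filter has-γ? cs
        from-regions : ∀ γ′ → γ ≡ γ′ → Result
        from-regions []        refl = ⊥-elim (disjoint-chain-short β≢[] ys valid′ ordered′ same-regions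
                                         (ℕP.<⇒≤ (ℕP.≤-<-trans (ℕP.m≤n+m p (suc b′)) many)))
        from-regions (σ₀ ∷ γ₀) refl = chain⇒Result ys valid′ ordered′ same-regions
                                         (ℕP.<⇒≤ (ℕP.≤-<-trans (ℕP.m≤m+n (suc b′) p) many))

    InClass? : ∀ cs h → Dec (InClass cs h)
    InClass? cs h = (regionsMet (V H) E* h ≟ₗ β) ×-dec All.all? Respects? cs
      where
        Respects? : ∀ r → Dec (Respects h r)
        Respects? r = ∀∈? (λ v → ((v ∈? edge r) →-dec (sig v ∈ₗ? regions r))
                          ×-dec ((sig v ∈ₗ? regions r) →-dec (v ∈? edge r))) h

    Split : Subset (n H) → Subset (n H) → Set
    Split g h = ∃ λ v → v ∈ₛ h × v ∈ₛ g × ∃ λ w → w ∈ₛ h × w ∉ₛ g × sig v ≡ sig w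

    Split? : ∀ g h → Dec (Split g h)
    Split? g h = ∃∈? (λ v → (v ∈? g) ×-dec ∃∈? (λ w → ¬? (w ∈? g) ×-dec (sig v ≟ₛ sig w)) h) h

    regionsIn : Subset (n H) → Subset (n H) → List (Subset (length E*))
    regionsIn g h = filter (λ σ → ∃∈? (λ v → (v ∈? g) ×-dec (sig v ≟ₛ σ)) h) β

    unsplit⇒Respects : ∀ {g h} → h ⊆ V H → Meets h → ¬ Split g h → Respects h (choice g (regionsIn g h))
    unsplit⇒Respects {g} {h} h⊆V meets unsplit {v} v∈h = into , out-of
      where
        into : v ∈ₛ g → sig v ∈ regionsIn g h
        into v∈g = ∈-filter⁺ _ (meets-signature h⊆V meets v∈h) (v , v∈h , v∈g , refl)
        out-of : sig v ∈ regionsIn g h → v ∈ₛ g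
        out-of sig∈ with v ∈? g
        ... | yes v∈g = v∈g
        ... | no v∉g  = let (_ , (u , u∈h , u∈g , same)) = ∈-filter⁻ _ {xs = β} sig∈
                        in ⊥-elim (unsplit (u , u∈h , u∈g , v , v∈h , v∉g , same))

    split⇒MeetsMany : ∀ {d Ec g h} → Extends Ec E* → h ∈ E H → Meets h → Split g h → k < suc d + length β →
      MeetsMany d (g ∷ Ec) h
    split⇒MeetsMany {d} {Ec} {g} {h} Ec⊒E* h∈ meets (v , v∈h , v∈g , w , w∈h , w∉g , same) many = begin-strict
      k                                   <⟨ many ⟩
      suc d + length β                    ≡⟨ cong (suc d +_) (sym (cong length meets)) ⟩
      suc d + regionsHit (V H) E* h       ≡⟨ sym (ℕP.+-suc d _) ⟩
      d + suc (regionsHit (V H) E* h)     ≤⟨ ℕP.+-monoʳ-≤ d split ⟩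
      d + regionsHit (V H) (g ∷ Ec) h     ∎
      where
        open ℕP.≤-Reasoning
        split = regionsHit-split (V H) g h (edge⊆V h∈) Ec⊒E* v∈h w∈h v∈g w∉g same

    -- g contains no region of Ec, and edge r is one of the edges of Ec, so the vertex of g in region σ
    -- has a twin outside g with the same Ec-signature, which therefore lies in edge r and in region σ.
    ¬ContainsRegion⇒Strict : ∀ {Ec g r} → Extends Ec E* → ¬ ContainsRegion (V H) Ec g → g ⊆ V H → Meets g →
      edge r ∈ Ec → regions r ⊆ₗ β → Respects g r → Strict g r
    ¬ContainsRegion⇒Strict {Ec} {g} {r} Ec⊒E* ¬contains g⊆V meets r∈Ec r⊆β respects σ∈ =
      let (v , v∈g , sig-v) = meets-vertex meets (r⊆β σ∈)
          v∈r = proj₂ (respects v∈g) (subst (_∈ regions r) (sym sig-v) σ∈)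
          (w , _ , same , w∉g) = escape (V H) Ec g ¬contains (g⊆V v∈g)
      in w , lookup⇒∈ (trans (signature-∈ r∈Ec same) (∈⇒lookup v∈r)) ,
         trans (signature-extends Ec⊒E* w v same) sig-v , w∉g

    record Growing (Ec : List (Subset (n H))) (fuel : ℕ) : Set where
      field
        choices : List (Choice (length E*))
        Ec⊒E*   : Extends Ec E*
        chosen  : All (λ r → edge r ∈ Ec) choices
        valid   : All Valid choices
        ordered : AllPairs Precedes choices
        room    : length choices + fuel ≡ chainLength (length β)

    Uncoloured : ∀ {Ec fuel} → Growing Ec fuel → Subset (n H) → Set
    Uncoloured c = InClass (Growing.choices c)

    start : Growing E* (chainLength (length β))
    start = record
      { choices = [] ; Ec⊒E* = extends-refl ; chosen = All.[] ; valid = All.[] ; ordered = [] ; room = refl }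

    grow : ∀ {Ec fuel} (c : Growing Ec (suc fuel)) {g γ} → Extends E* es₀ → g ∈ E H → Uncoloured c g →
      CompatibleWith Ec g → γ ∈ sublists β → Growing (g ∷ Ec) fuel
    grow {Ec} {fuel} c {g} {γ} E*⊒es₀ g∈ (meets , respects) compatible γ∈ = record
      { choices = choice g γ ∷ choices
      ; Ec⊒E*   = extends-∷ g Ec⊒E*
      ; chosen  = here refl All.∷ All.map there chosen
      ; valid   = new-valid All.∷ valid
      ; ordered = All.tabulate (λ r∈ → All.lookup respects r∈ , strict r∈) ∷ ordered
      ; room    = trans (sym (ℕP.+-suc (length choices) fuel)) room
      }
      where
        open Growing c
        strict : ∀ {r} → r ∈ choices → Strict g r
        strict r∈ = ¬ContainsRegion⇒Strict Ec⊒E* (proj₂ compatible) (edge⊆V g∈) meets (All.lookup chosen r∈)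
          (∈-sublists⇒⊆ β (regions∈ (All.lookup valid r∈))) (All.lookup respects r∈)
        new-valid : Valid (choice g γ)
        new-valid = record
          { edge∈E = g∈ ; meets = meets ; regions∈ = γ∈
          ; compatible = CompatibleEdge-extends (edge⊆V g∈) (extends-trans Ec⊒E* E*⊒es₀) compatible }

  t+K≥1 : 1 ≤ t + K
  t+K≥1 = ℕP.≤-trans t≥1 (ℕP.m≤m+n t K)

  record Stage (d : ℕ) (E* : List (Subset (n H))) (β : List (Subset (length E*))) : Set where
    field
      E*⊒es₀ : Extends E* es₀
      β≢[]   : 1 ≤ length β
      many   : k < suc d + length β
      d<k    : suc d ≤ k

  mutual
    colourMeetsMany : ∀ d Ec → d ≤ k → Extends Ec es₀ → FindOrColour (MeetsMany d Ec) (meetsManyBound d (length Ec))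
    colourMeetsMany zero    Ec _   _ = inj₂ (colourable-weaken (λ h _ many → inj₁ (subst (_≤ regionsHit (V H) Ec h) 1+k≡t+ℓ many))
                                             ℕP.≤-refl (incompatibleColouring Ec))
    colourMeetsMany (suc d) Ec d<k Ec⊒es₀ = findOrColour-weaken by-regions ℕP.≤-refl
      (findOrColour-⊎ (inj₂ (incompatibleColouring Ec)) (findOrColour-⋃ (sublists (allSubsets (length Ec))) with-regions))
      where
        OfRegions : List (Subset (length Ec)) → Subset (n H) → Set
        OfRegions β h = MeetsMany (suc d) Ec h × regionsMet (V H) Ec h ≡ β
        by-regions : ∀ h → h ∈ E H → MeetsMany (suc d) Ec h →
          Incompatible Ec h ⊎ ∃ λ β → β ∈ sublists (allSubsets (length Ec)) × OfRegions β h
        by-regions h _ many with classify Ec h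
        ... | inj₂ incompatible = inj₁ incompatible
        ... | inj₁ _ = inj₂ (regionsMet (V H) Ec h , filter∈sublists _ (allSubsets (length Ec)) , many , refl)
        with-regions : ∀ {β} → β ∈ sublists (allSubsets (length Ec)) →
          FindOrColour (OfRegions β) (chainBound d (length Ec) (length β) (chainLength (length β)))
        with-regions {β} _ with 1 ≤? length β | k <? suc d + length β
        ... | yes β≢[] | yes many =
          findOrColour-weaken (λ h _ (_ , meets) → meets , All.[]) ℕP.≤-refl
            (growChain (record { E*⊒es₀ = Ec⊒es₀ ; β≢[] = β≢[] ; many = many ; d<k = d<k }) (Chain.start Ec β))
        ... | no β≡[] | _ =
          inj₂ (colourable-∅ (chainBound-positive t+K≥1 d (length Ec) (length β) (chainLength (length β)))
            λ h _ (many , meets) → β≡[] (subst (λ β → 1 ≤ length β) meets (1≤-summand many d<k)))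
        ... | yes _ | no few =
          inj₂ (colourable-∅ (chainBound-positive t+K≥1 d (length Ec) (length β) (chainLength (length β)))
            λ h _ (many , meets) → few (subst (λ β → k < suc d + length β) meets many))

    growChain : ∀ {d E* β} → Stage d E* β → ∀ {Ec fuel} (c : Chain.Growing E* β Ec fuel) →
      FindOrColour (Chain.Uncoloured E* β c) (chainBound d (length Ec) (length β) fuel)
    growChain {E* = E*} {β} stage {fuel = zero} c =
      inj₁ (long-chain⇒Result (Stage.β≢[] stage) choices valid ordered
             (ℕP.≤-reflexive (trans (sym room) (ℕP.+-identityʳ _))))
      where
        open Chain E* β
        open Growing c
    growChain {d} {E*} {β} stage {Ec} {suc fuel} c = findOrColour-weaken by-compatibility ℕP.≤-refl
      (findOrColour-⊎ (inj₂ (incompatibleColouring Ec)) compatible-part)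
      where
        open Chain E* β
        by-compatibility : ∀ h → h ∈ E H → Uncoloured c h → Incompatible Ec h ⊎ (Uncoloured c h × CompatibleWith Ec h)
        by-compatibility h _ uncoloured with classify Ec h
        ... | inj₁ compatible   = inj₂ (uncoloured , compatible)
        ... | inj₂ incompatible = inj₁ incompatible
        compatible-part : FindOrColour (λ h → Uncoloured c h × CompatibleWith Ec h) (extensionBound d (length Ec) (length β) fuel)
        compatible-part with Any.any? (λ h → InClass? (Growing.choices c) h ×-dec Compatible? Ec h) (E H)
        ... | yes some = let (g , g∈ , uncoloured , compatible) = find some in extendChain stage c g∈ uncoloured compatible
        ... | no none  = inj₂ (colourable-∅ (extensionBound-positive t+K≥1 d (length Ec) (length β) fuel)
                                λ h h∈ P → none (lose h∈ P))

    extendChain : ∀ {d E* β} → Stage d E* β → ∀ {Ec fuel} (c : Chain.Growing E* β Ec (suc fuel)) {g} → g ∈ E H →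
      Chain.Uncoloured E* β c g → CompatibleWith Ec g →
      FindOrColour (λ h → Chain.Uncoloured E* β c h × CompatibleWith Ec h) (extensionBound d (length Ec) (length β) fuel)
    extendChain {d} {E*} {β} stage {Ec} {fuel} c {g} g∈ uncoloured compatible =
      findOrColour-weaken by-split (ℕP.≤-reflexive bound≡)
        (findOrColour-⊎ (inj₂ (incompatibleColouring (g ∷ Ec)))
          (findOrColour-⊎ (colourMeetsMany d (g ∷ Ec) (ℕP.<⇒≤ d<k) (extends-∷ g (extends-trans Ec⊒E* E*⊒es₀)))
            (findOrColour-⋃ (sublists β) continue)))
      where
        open Chain E* β
        open Growing c
        open Stage stage
        L′ = suc (length Ec)
        continue : ∀ {γ} → γ ∈ sublists β → FindOrColour (InClass (choice g γ ∷ choices)) (chainBound d L′ (length β) fuel)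
        continue γ∈ = growChain stage (grow c E*⊒es₀ g∈ uncoloured compatible γ∈)
        by-split : ∀ h → h ∈ E H → Uncoloured c h × CompatibleWith Ec h →
          Incompatible (g ∷ Ec) h ⊎ (MeetsMany d (g ∷ Ec) h ⊎ ∃ λ γ → γ ∈ sublists β × InClass (choice g γ ∷ choices) h)
        by-split h h∈ ((meets , respects) , _) with classify (g ∷ Ec) h | Split? g h
        ... | inj₂ incompatible | _          = inj₁ incompatible
        ... | inj₁ _            | yes split  = inj₂ (inj₁ (split⇒MeetsMany Ec⊒E* h∈ meets split many))
        ... | inj₁ _            | no unsplit = inj₂ (inj₂ (regionsIn g h , filter∈sublists _ β , meets ,
                                                          unsplit⇒Respects (edge⊆V h∈) meets unsplit All.∷ respects))
        bound≡ : incompatibleBound (t + K) L′ *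
                   (meetsManyBound d L′ * product (map (λ _ → chainBound d L′ (length β) fuel) (sublists β)))
               ≡ extensionBound d (length Ec) (length β) fuel
        bound≡ = cong (λ x → incompatibleBound (t + K) L′ * (meetsManyBound d L′ * x))
          (trans (product-map-const _ (sublists β)) (cong (chainBound d L′ (length β) fuel ^_) (length-sublists β)))

  -- For d = k every non-empty edge meets more than k − d regions, so the colouring would be strong.
  find-bromeliad : ChiAtLeast H (t + ℓ) (suc (meetsManyBound k (length es₀))) → Result
  find-bromeliad χ≥ with colourMeetsMany k es₀ ℕP.≤-refl extends-refl
  ... | inj₁ result                = result
  ... | inj₂ (f , strong-many , ≤R) = ⊥-elim (ℕP.<-irrefl refl (ℕP.≤-trans (χ≥ f strong) ≤R))
    where
      strong : Strong H (t + ℓ) f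
      strong e e∈ with nonempty? e
      ... | yes (v , v∈e) = strong-many e e∈ (ℕP.m<m+n k (regionsHit-positive (V H) es₀ (edge⊆V e∈) v∈e))
      ... | no empty      = ℕP.≤-trans (ℕP.m⊓n≤n (t + ℓ) ∣ e ∣) (subst (_≤ numColours e f) (sym ∣e∣≡0) z≤n)
        where ∣e∣≡0 = trans (cong ∣_∣ (Empty-unique empty)) (∣⊥∣≡0 (n H))

corollary3p3 : (t ℓ p χ L b : ℕ) → 1 ≤ t → 1 ≤ ℓ → 2 ≤ p → 1 ≤ χ → 1 ≤ L → 1 ≤ b →
  (∀ t' → t' < t → ∃[ K ] (∀ (G : Hypergraph) → Wf G →
    NoSunflower G p t' →
    (∀ (S' : Subset (n G)) → S' ⊆ V G → ∣ S' ∣ ≡ t' → ChiAtMost (link G S') ℓ χ) →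
    ChiAtMost G (t' + ℓ) K)) →
  ∃[ K₃ ] (1 ≤ K₃ × (∀ (H : Hypergraph) (es : List (Subset (n H))) → Wf H →
    length es ≡ L → All (_∈ E H) es →
    NoSunflower H p t →
    (∀ (S : Subset (n H)) → S ⊆ V H → ∣ S ∣ ≡ t → ChiAtMost (link H S) ℓ χ) →
    SplitDegenerate H (t + ℓ ∸ 1) es →
    ChiAtLeast H (t + ℓ) K₃ →
    Σ (Bromeliad H b) (λ B → Compatible H (t + ℓ ∸ 1) es b B)))
corollary3p3 t ℓ p χ L zero     _   _ _   _ _ () _
corollary3p3 t ℓ p χ L (suc b′) t≥1 _ p≥2 _ _ _  bounds =
  suc (meetsManyBound (t + ℓ ∸ 1) L) , s≤s z≤n ,
  λ H es wf length≡L _ noSunflower links split-degenerate χ≥ →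
    ChainArgument.find-bromeliad H t ℓ p χ K t≥1 wf noSunflower links smaller (ℕP.m≤m⊔n χ M) p≥2 b′ es split-degenerate
      (subst (λ L → ChiAtLeast H (t + ℓ) (suc (meetsManyBound (t + ℓ ∸ 1) L))) (sym length≡L) χ≥)
  where
    uniform : ∃ λ M → ∀ s → s < t → ColouringBound p s ℓ χ M
    uniform = common-bound ColouringBound-mono t bounds
    M = proj₁ uniform
    K = χ ⊔ M
    smaller : ∀ s → s < t → ColouringBound p s ℓ χ K
    smaller s s<t = ColouringBound-mono (ℕP.m≤n⊔m χ M) (proj₂ uniform s s<t)
    open Bounds (t + K) (suc b′ + p)
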